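{- Let $\mathcal C(\Lambda_1)$ be the linear code associated to the projective system $\Lambda_1\subseteq\mathrm{PG}(M_{n+1}(q))$ of points $[x\xi]$ with $x$ a nonzero column vector, $\xi$ a nonzero row vector of $\mathbb F_q^{n+1}$, $\xi x=0$. The set of weights of $\mathcal C(\Lambda_1)$ is \[\Big\{q^{n-1}\frac{q^{n+1}-1}{q-1}-q^{n-1}\theta_M : M\in M_{n+1}(q)\Big\}.\]
   Context: For $M\in M_{n+1}(q)$, $\theta_M$ is the number of points of $\mathrm{PG}(\mathbb F_q^{n+1})$ (row vectors) whose representatives $\xi$ are left eigenvectors of $M$, i.e. $\xi M=\lambda\xi$ for some $\lambda\in\mathbb F_q$; equivalently $\theta_M=\nu_M/(q-1)$ with $\nu_M$ the number of nonzero left eigenvectors of $M$. -}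

module Defs where

open import Data.Nat as ℕ using (ℕ; zero; suc; _∸_; _^_)
open import Data.Bool using (Bool; true; false; _∧_; not; if_then_else_)
open import Data.List as List using (List; []; _∷_; length; filter; map; concatMap)
open import Data.Bool.ListAction using (any)
open import Data.List.Membership.Propositional using (_∈_)
open import Data.List.Relation.Unary.Unique.Propositional using (Unique)
open import Data.Vec as Vec using (Vec; []; _∷_; tabulate; lookup; zipWith)
import Data.Vec.Properties as VecP
open import Data.Fin using (Fin)
open import Data.Product using (Σ; _×_; _,_)
open import Relation.Nullary using (¬_; does)
open import Relation.Binary.PropositionalEquality using (_≡_)
open import Relation.Binary.Definitions using (DecidableEquality)
import Algebra.Structures as AS

record FiniteField : Set₁ where
  field
    Carrier : Set
    _+_ _*_ : Carrier → Carrier → Carrier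
    -_      : Carrier → Carrier
    0# 1#   : Carrier
    isCommutativeRing : AS.IsCommutativeRing _≡_ _+_ _*_ -_ 0# 1#
    0≢1     : ¬ (0# ≡ 1#)
    inverse : ∀ x → ¬ (x ≡ 0#) → Σ Carrier λ y → x * y ≡ 1#
    _≟_     : DecidableEquality Carrier
    elems   : List Carrier
    complete : ∀ x → x ∈ elems
    unique  : Unique elems

  q : ℕ
  q = length elems

module _ (F : FiniteField) where
  open FiniteField F

  allVecsOf : {A : Set} → List A → (k : ℕ) → List (Vec A k)
  allVecsOf xs zero    = [] ∷ []
  allVecsOf xs (suc k) = concatMap (λ x → map (x ∷_) (allVecsOf xs k)) xs

  Vector : ℕ → Set
  Vector k = Vec Carrier k

  allVectors : (k : ℕ) → List (Vector k)
  allVectors k = allVecsOf elems k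

  -- M_m(q) : m × m matrices, as rows
  Mat : ℕ → Set
  Mat m = Vec (Vec Carrier m) m

  allMats : (m : ℕ) → List (Mat m)
  allMats m = allVecsOf (allVectors m) m

  _==_ : Carrier → Carrier → Bool
  a == b = does (a ≟ b)

  _==V_ : {k : ℕ} → Vector k → Vector k → Bool
  u ==V v = does (VecP.≡-dec _≟_ u v)

  _==M_ : {m : ℕ} → Mat m → Mat m → Bool
  A ==M B = does (VecP.≡-dec (VecP.≡-dec _≟_) A B)

  isZeroV : {k : ℕ} → Vector k → Bool
  isZeroV []       = true
  isZeroV (x ∷ xs) = (x == 0#) ∧ isZeroV xs

  -- A nonzero vector is the normalised representative of its projective point
  -- iff its first nonzero entry is 1.
  normalised : {k : ℕ} → Vector k → Bool
  normalised []       = false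
  normalised (x ∷ xs) = if x == 0# then normalised xs else (x == 1#)

  sumF : {k : ℕ} → Vector k → Carrier
  sumF []       = 0#
  sumF (x ∷ xs) = x + sumF xs

  dot : {k : ℕ} → Vector k → Vector k → Carrier
  dot ξ x = sumF (zipWith _*_ ξ x)

  outer : {m : ℕ} → Vector m → Vector m → Mat m
  outer x ξ = Vec.map (λ xi → Vec.map (xi *_) ξ) x

  rowMul : {m : ℕ} → Vector m → Mat m → Vector m
  rowMul ξ M = tabulate λ j → dot ξ (Vec.map (λ row → lookup row j) M)

  scaleV : {k : ℕ} → Carrier → Vector k → Vector k
  scaleV c = Vec.map (c *_)

  addM : {m : ℕ} → Mat m → Mat m → Mat m
  addM = zipWith (zipWith _+_)

  scaleM : {m : ℕ} → Carrier → Mat m → Mat m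
  scaleM c = Vec.map (scaleV c)

  flatten : {m : ℕ} → Mat m → Vec Carrier (m ℕ.* m)
  flatten = Vec.concat

  -- Λ₁ ⊆ PG(M_{n+1}(q)): points [x ξ] with x, ξ nonzero, ξ x = 0.
  -- Each point is listed once, by its normalised representative matrix.

  inCone : {m : ℕ} → Mat m → Bool
  inCone {m} A =
    any (λ x → any (λ ξ → not (isZeroV x) ∧ not (isZeroV ξ)
                          ∧ (dot ξ x == 0#) ∧ (outer x ξ ==M A))
                   (allVectors m))
        (allVectors m)

  Λ₁ : (n : ℕ) → List (Mat (suc n))
  Λ₁ n = filter (λ A → Data.Bool.T? (normalised (flatten A) ∧ inCone A)) (allMats (suc n))
    where import Data.Bool

  IsLinear : {m : ℕ} → (Mat m → Carrier) → Set
  IsLinear {m} φ = (∀ A B → φ (addM A B) ≡ φ A + φ B)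
                 × (∀ c A → φ (scaleM c A) ≡ c * φ A)

  codeword : (n : ℕ) → (Mat (suc n) → Carrier) → List Carrier
  codeword n φ = map φ (Λ₁ n)

  weight : List Carrier → ℕ
  weight c = length (filter (λ a → Data.Bool.T? (not (a == 0#))) c)
    where import Data.Bool

  IsWeightOfCΛ₁ : (n : ℕ) → ℕ → Set
  IsWeightOfCΛ₁ n w = Σ (Mat (suc n) → Carrier) λ φ → IsLinear φ × weight (codeword n φ) ≡ w

  -- θ_M: number of points of PG(F_q^{n+1}) whose representatives are
  -- left eigenvectors of M (counted via normalised representatives).

  isLeftEigen : {m : ℕ} → Mat m → Vector m → Bool
  isLeftEigen M ξ = any (λ λ' → rowMul ξ M ==V scaleV λ' ξ) elems

  θ : {m : ℕ} → Mat m → ℕ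
  θ {m} M = length (filter (λ ξ → Data.Bool.T? (normalised ξ ∧ isLeftEigen M ξ)) (allVectors m))
    where import Data.Bool

  -- (q^{n+1} - 1)/(q - 1) = 1 + q + ... + q^n
  projCount : ℕ → ℕ
  projCount zero    = 1
  projCount (suc n) = q ^ suc n ℕ.+ projCount n

{-# OPTIONS --safe #-}
-- Every linear functional on M_{n+1}(q) is A ↦ tr (M A) for a matrix M, and tr (M · x ξ) = (ξ M) x.
-- Each point of Λ₁ has exactly one representative x ξ with x and ξ normalised (first nonzero entry 1),
-- so the weight of the codeword of M counts the pairs of projective points [ξ], [x] with ξ x = 0 and
-- (ξ M) x ≠ 0. For fixed [ξ] these are the points of the hyperplane ξ^⊥ off (ξ M)^⊥: none if ξ is a
-- left eigenvector of M, and q^(n-1) otherwise, because two independent linear forms on F_q^(n+1)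
-- have q^(n-1) common zeros, and scaling by F_q^* turns affine counts into (q - 1) times projective
-- ones. Summing over the projCount points [ξ] gives q^(n-1) (projCount - θ_M).
module Submission where

open import Defs
open import Data.Nat using (ℕ; suc; _∸_; _*_; _^_)
open import Data.Product using (Σ; _×_)
open import Relation.Binary.PropositionalEquality using (_≡_)

open import Data.Nat as ℕ using (zero) renaming (_+_ to _+ℕ_; _*_ to _*ℕ_)
import Data.Nat.Properties as ℕ
open import Data.Bool using (Bool; true; false; _∧_; not; T?; if_then_else_)
open import Data.Bool.Properties using (T-≡)
open import Data.Bool.ListAction using (any)
open import Data.List using (List; []; _∷_; _++_; length; filter; map; concatMap)
open import Data.List.Properties using (map-cong)
open import Data.List.Membership.Propositional using (_∈_; lose)
open import Data.List.Membership.Propositional.Properties using (∈-map⁺; ∈-concatMap⁺)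
open import Data.List.Relation.Unary.Any using (here; there; satisfied)
open import Data.List.Relation.Unary.Any.Properties using (any⁺; any⁻)
open import Data.List.Relation.Unary.All using (All; _∷_)
open import Data.List.Relation.Unary.AllPairs using (_∷_)
open import Data.List.Relation.Unary.Unique.Propositional using (Unique)
open import Data.Vec using (Vec; []; _∷_; zipWith; lookup; tabulate; replicate)
import Data.Vec.Properties as Vec
open import Data.Fin using (Fin) renaming (zero to fzero; suc to fsuc)
open import Data.Product using (_,_; proj₁; proj₂)
open import Data.Empty using (⊥-elim)
open import Function using (_$_; _∘_)
open import Function.Bundles using (_⇔_; mk⇔; Equivalence)
open import Relation.Nullary using (Dec; yes; no; does; ¬_)
open import Relation.Nullary.Decidable using (does-⇔; dec-true)
open import Relation.Binary.Definitions using (DecidableEquality)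
open import Relation.Binary.PropositionalEquality
open import Algebra.Bundles using (CommutativeRing)
open import Algebra.Properties.CommutativeSemigroup ℕ.+-commutativeSemigroup using () renaming (interchange to +ℕ-interchange)

when : Bool → ℕ → ℕ
when true  n = n
when false n = 0

∑ : {A : Set} → List A → (A → ℕ) → ℕ
∑ []       f = 0
∑ (x ∷ xs) f = f x +ℕ ∑ xs f

syntax ∑ xs (λ x → e) = ∑[ x ← xs ] e

when-∧ : ∀ a b n → when (a ∧ b) n ≡ when a (when b n)
when-∧ true  b n = refl
when-∧ false b n = refl

when-congʳ : ∀ b {m n} → (b ≡ true → m ≡ n) → when b m ≡ when b n
when-congʳ true  m≡n = m≡n refl
when-congʳ false m≡n = refl

when-zero : ∀ b → when b 0 ≡ 0
when-zero true  = refl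
when-zero false = refl

when-+ : ∀ b m n → when b (m +ℕ n) ≡ when b m +ℕ when b n
when-+ true  m n = refl
when-+ false m n = refl

when≡*when1 : ∀ b n → when b n ≡ n *ℕ when b 1
when≡*when1 true  n = sym (ℕ.*-identityʳ n)
when≡*when1 false n = sym (ℕ.*-zeroʳ n)

when+when-not : ∀ b n → when b n +ℕ when (not b) n ≡ n
when+when-not true  n = ℕ.+-identityʳ n
when+when-not false n = refl

does-true : {P : Set} (p? : Dec P) → does p? ≡ true → P
does-true (yes p) _ = p

module _ {A : Set} where

  any-true : (p : A → Bool) (xs : List A) → any p xs ≡ true → Σ A λ x → p x ≡ true
  any-true p xs any≡true with x , px ← satisfied (any⁻ p xs (Equivalence.from T-≡ any≡true)) =
    x , Equivalence.to T-≡ px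

  any-intro : (p : A → Bool) {xs : List A} {x : A} → x ∈ xs → p x ≡ true → any p xs ≡ true
  any-intro p x∈xs px = Equivalence.to T-≡ (any⁺ p (lose x∈xs (Equivalence.from T-≡ px)))

  ∑-cong : (xs : List A) {f g : A → ℕ} → (∀ x → f x ≡ g x) → ∑ xs f ≡ ∑ xs g
  ∑-cong []       f≗g = refl
  ∑-cong (x ∷ xs) f≗g = cong₂ _+ℕ_ (f≗g x) (∑-cong xs f≗g)

  ∑-zero : (xs : List A) {f : A → ℕ} → (∀ x → f x ≡ 0) → ∑ xs f ≡ 0
  ∑-zero []       f≗0 = refl
  ∑-zero (x ∷ xs) f≗0 = cong₂ _+ℕ_ (f≗0 x) (∑-zero xs f≗0)

  ∑-+ : (xs : List A) (f g : A → ℕ) → ∑[ x ← xs ] (f x +ℕ g x) ≡ ∑ xs f +ℕ ∑ xs g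
  ∑-+ []       f g = refl
  ∑-+ (x ∷ xs) f g = trans (cong (f x +ℕ g x +ℕ_) (∑-+ xs f g)) (+ℕ-interchange (f x) (g x) _ _)

  ∑-*ˡ : (xs : List A) (c : ℕ) (f : A → ℕ) → ∑[ x ← xs ] (c *ℕ f x) ≡ c *ℕ ∑ xs f
  ∑-*ˡ []       c f = sym (ℕ.*-zeroʳ c)
  ∑-*ˡ (x ∷ xs) c f = trans (cong (c *ℕ f x +ℕ_) (∑-*ˡ xs c f)) (sym (ℕ.*-distribˡ-+ c (f x) _))

  ∑-when : (xs : List A) (b : Bool) (f : A → ℕ) → ∑[ x ← xs ] when b (f x) ≡ when b (∑ xs f)
  ∑-when xs true  f = refl
  ∑-when xs false f = ∑-zero xs (λ _ → refl)

  ∑-const : (xs : List A) (c : ℕ) → ∑[ _ ← xs ] c ≡ length xs *ℕ c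
  ∑-const []       c = refl
  ∑-const (x ∷ xs) c = cong (c +ℕ_) (∑-const xs c)

  ∑-++ : (xs ys : List A) (f : A → ℕ) → ∑ (xs ++ ys) f ≡ ∑ xs f +ℕ ∑ ys f
  ∑-++ []       ys f = refl
  ∑-++ (x ∷ xs) ys f = trans (cong (f x +ℕ_) (∑-++ xs ys f)) (sym (ℕ.+-assoc (f x) _ _))

  ∑-split : (xs : List A) (p : A → Bool) (f : A → ℕ) →
    ∑ xs f ≡ ∑[ x ← xs ] when (p x) (f x) +ℕ ∑[ x ← xs ] when (not (p x)) (f x)
  ∑-split xs p f = trans (∑-cong xs (λ x → sym (when+when-not (p x) (f x)))) (∑-+ xs _ _)

  ∑-filter : (xs : List A) (p : A → Bool) (f : A → ℕ) →
    ∑ (filter (λ x → T? (p x)) xs) f ≡ ∑[ x ← xs ] when (p x) (f x)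
  ∑-filter []       p f = refl
  ∑-filter (x ∷ xs) p f with p x
  ... | true  = cong (f x +ℕ_) (∑-filter xs p f)
  ... | false = ∑-filter xs p f

  length-filter≡∑ : (xs : List A) (p : A → Bool) →
    length (filter (λ x → T? (p x)) xs) ≡ ∑[ x ← xs ] when (p x) 1
  length-filter≡∑ xs p = trans (length≡∑ (filter (λ x → T? (p x)) xs)) (∑-filter xs p (λ _ → 1))
    where
    length≡∑ : (ys : List A) → length ys ≡ ∑[ _ ← ys ] 1
    length≡∑ []       = refl
    length≡∑ (y ∷ ys) = cong suc (length≡∑ ys)

  Sifting : DecidableEquality A → List A → Set
  Sifting _≟_ xs = ∀ z (g : A → ℕ) → ∑[ y ← xs ] when (does (y ≟ z)) (g y) ≡ g z

  unique-complete⇒sifting : (_≟_ : DecidableEquality A) (xs : List A) →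
    Unique xs → (∀ z → z ∈ xs) → Sifting _≟_ xs
  unique-complete⇒sifting _≟_ xs uniq complete z g = sift xs uniq (complete z)
    where
    absent : (ys : List A) → All (z ≢_) ys → ∑[ y ← ys ] when (does (y ≟ z)) (g y) ≡ 0
    absent []       _           = refl
    absent (y ∷ ys) (z≢y ∷ z∉ys) with y ≟ z
    ... | yes y≡z = ⊥-elim (z≢y (sym y≡z))
    ... | no  _   = absent ys z∉ys

    sift : (ys : List A) → Unique ys → z ∈ ys → ∑[ y ← ys ] when (does (y ≟ z)) (g y) ≡ g z
    sift (y ∷ ys) (y∉ys ∷ _) z∈ with y ≟ z
    sift (y ∷ ys) (y∉ys ∷ _) z∈         | yes refl = trans (cong (g y +ℕ_) (absent ys y∉ys)) (ℕ.+-identityʳ (g y))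
    sift (y ∷ ys) _          (here z≡y) | no  y≢z  = ⊥-elim (y≢z (sym z≡y))
    sift (y ∷ ys) (_ ∷ uniq) (there z∈) | no  _    = sift ys uniq z∈

module _ {A B : Set} where

  ∑-map : (xs : List A) (g : A → B) (f : B → ℕ) → ∑ (map g xs) f ≡ ∑[ x ← xs ] f (g x)
  ∑-map []       g f = refl
  ∑-map (x ∷ xs) g f = cong (f (g x) +ℕ_) (∑-map xs g f)

  ∑-concatMap : (xs : List A) (g : A → List B) (f : B → ℕ) →
    ∑ (concatMap g xs) f ≡ ∑[ x ← xs ] ∑ (g x) f
  ∑-concatMap []       g f = refl
  ∑-concatMap (x ∷ xs) g f = trans (∑-++ (g x) _ f) (cong (∑ (g x) f +ℕ_) (∑-concatMap xs g f))

  ∑-comm : (xs : List A) (ys : List B) (f : A → B → ℕ) →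
    ∑[ x ← xs ] ∑[ y ← ys ] f x y ≡ ∑[ y ← ys ] ∑[ x ← xs ] f x y
  ∑-comm []       ys f = sym (∑-zero ys (λ _ → refl))
  ∑-comm (x ∷ xs) ys f =
    trans (cong (∑ ys (f x) +ℕ_) (∑-comm xs ys f)) (sym (∑-+ ys (f x) _))

module _ (F : FiniteField) where

  open FiniteField F using (Carrier; isCommutativeRing; 0≢1; inverse; _≟_; elems; complete; unique; q)

  ring : CommutativeRing _ _
  ring = record { isCommutativeRing = isCommutativeRing }

  open CommutativeRing ring
    using (_+_; -_; 0#; 1#; +-comm; +-assoc; *-comm; *-assoc; +-identityˡ; +-identityʳ;
           *-identityˡ; *-identityʳ; zeroˡ; zeroʳ; distribˡ; distribʳ; -‿inverseˡ; -‿inverseʳ)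
    renaming (_*_ to _·_)
  open import Algebra.Properties.Ring (CommutativeRing.ring ring) using (-‿distribˡ-*; -‿distribʳ-*)
  open import Algebra.Properties.CommutativeMonoid.Sum (CommutativeRing.+-commutativeMonoid ring)
    using (sum; sum-cong-≗; ∑-distrib-+)
  open import Algebra.Properties.Semiring.Sum (CommutativeRing.semiring ring) using (*-distribˡ-sum; *-distribʳ-sum)
  open import Algebra.Properties.CommutativeSemigroup (CommutativeRing.*-commutativeSemigroup ring)
    using (x∙yz≈y∙xz; xy∙z≈zx∙y) renaming (interchange to ·-interchange)
  open import Algebra.Properties.CommutativeSemigroup (CommutativeRing.+-commutativeSemigroup ring)
    using () renaming (interchange to +-interchange)

  infix 4 _≐_
  _≐_ : Carrier → Carrier → Bool
  a ≐ b = does (a ≟ b)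

  ≐-refl : ∀ a → (a ≐ a) ≡ true
  ≐-refl a with a ≟ a
  ... | yes _  = refl
  ... | no a≢a = ⊥-elim (a≢a refl)

  ≐-true : ∀ {a b} → (a ≐ b) ≡ true → a ≡ b
  ≐-true {a} {b} a≐b with a ≟ b
  ... | yes a≡b = a≡b

  0≐1 : (0# ≐ 1#) ≡ false
  0≐1 with 0# ≟ 1#
  ... | yes 0≡1 = ⊥-elim (0≢1 0≡1)
  ... | no  _   = refl

  1≐0 : (1# ≐ 0#) ≡ false
  1≐0 with 1# ≟ 0#
  ... | yes 1≡0 = ⊥-elim (0≢1 (sym 1≡0))
  ... | no  _   = refl

  inv : (a : Carrier) → a ≢ 0# → Carrier
  inv a a≢0 = proj₁ (inverse a a≢0)

  inverseʳ : ∀ a (a≢0 : a ≢ 0#) → a · inv a a≢0 ≡ 1#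
  inverseʳ a a≢0 = proj₂ (inverse a a≢0)

  inverseˡ : ∀ a (a≢0 : a ≢ 0#) → inv a a≢0 · a ≡ 1#
  inverseˡ a a≢0 = trans (*-comm _ a) (inverseʳ a a≢0)

  inv-cancelˡ : ∀ a (a≢0 : a ≢ 0#) b → inv a a≢0 · (a · b) ≡ b
  inv-cancelˡ a a≢0 b = begin
    inv a a≢0 · (a · b) ≡⟨ sym (*-assoc _ a b) ⟩
    (inv a a≢0 · a) · b ≡⟨ cong (_· b) (inverseˡ a a≢0) ⟩
    1# · b              ≡⟨ *-identityˡ b ⟩
    b                   ∎
    where open ≡-Reasoning

  inv-cancelʳ : ∀ a (a≢0 : a ≢ 0#) b → a · (inv a a≢0 · b) ≡ b
  inv-cancelʳ a a≢0 b = begin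
    a · (inv a a≢0 · b) ≡⟨ sym (*-assoc a _ b) ⟩
    (a · inv a a≢0) · b ≡⟨ cong (_· b) (inverseʳ a a≢0) ⟩
    1# · b              ≡⟨ *-identityˡ b ⟩
    b                   ∎
    where open ≡-Reasoning

  ·-inv-cancelʳ : ∀ a (a≢0 : a ≢ 0#) b → (b · inv a a≢0) · a ≡ b
  ·-inv-cancelʳ a a≢0 b = trans (*-assoc b _ a) (trans (cong (b ·_) (inverseˡ a a≢0)) (*-identityʳ b))

  ·-cancelˡ : ∀ a {b c} → a ≢ 0# → a · b ≡ a · c → b ≡ c
  ·-cancelˡ a {b} {c} a≢0 ab≡ac = begin
    b                   ≡⟨ sym (inv-cancelˡ a a≢0 b) ⟩
    inv a a≢0 · (a · b) ≡⟨ cong (inv a a≢0 ·_) ab≡ac ⟩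
    inv a a≢0 · (a · c) ≡⟨ inv-cancelˡ a a≢0 c ⟩
    c                   ∎
    where open ≡-Reasoning

  ·-zero⇒zeroʳ : ∀ a {b} → a ≢ 0# → a · b ≡ 0# → b ≡ 0#
  ·-zero⇒zeroʳ a a≢0 ab≡0 = ·-cancelˡ a a≢0 (trans ab≡0 (sym (zeroʳ a)))

  inv≢0 : ∀ a (a≢0 : a ≢ 0#) → inv a a≢0 ≢ 0#
  inv≢0 a a≢0 a⁻¹≡0 = 0≢1 (begin
    0#            ≡⟨ sym (zeroʳ a) ⟩
    a · 0#        ≡⟨ cong (a ·_) (sym a⁻¹≡0) ⟩
    a · inv a a≢0 ≡⟨ inverseʳ a a≢0 ⟩
    1#            ∎)
    where open ≡-Reasoning

  ·≐0 : ∀ a b → a ≢ 0# → (a · b ≐ 0#) ≡ (b ≐ 0#)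
  ·≐0 a b a≢0 = does-⇔ (mk⇔ (·-zero⇒zeroʳ a a≢0) (λ b≡0 → trans (cong (a ·_) b≡0) (zeroʳ a)))
                       ((a · b) ≟ 0#) (b ≟ 0#)

  +-neg-cancelʳ : ∀ x d → (x + d) + - d ≡ x
  +-neg-cancelʳ x d = trans (+-assoc x d (- d)) (trans (cong (x +_) (-‿inverseʳ d)) (+-identityʳ x))

  affine-solution : ∀ a (a≢0 : a ≢ 0#) d c y → (a · y + d ≡ c) ⇔ (y ≡ inv a a≢0 · (c + - d))
  affine-solution a a≢0 d c y = mk⇔ to from
    where
    open ≡-Reasoning
    a⁻¹ = inv a a≢0
    to : a · y + d ≡ c → y ≡ a⁻¹ · (c + - d)
    to ay+d≡c = begin
      y                         ≡⟨ sym (inv-cancelˡ a a≢0 y) ⟩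
      a⁻¹ · (a · y)             ≡⟨ cong (a⁻¹ ·_) (sym (+-neg-cancelʳ (a · y) d)) ⟩
      a⁻¹ · ((a · y + d) + - d) ≡⟨ cong (λ t → a⁻¹ · (t + - d)) ay+d≡c ⟩
      a⁻¹ · (c + - d)           ∎
    from : y ≡ a⁻¹ · (c + - d) → a · y + d ≡ c
    from refl = begin
      a · (a⁻¹ · (c + - d)) + d ≡⟨ cong (_+ d) (inv-cancelʳ a a≢0 _) ⟩
      (c + - d) + d             ≡⟨ trans (+-assoc c (- d) d) (trans (cong (c +_) (-‿inverseˡ d)) (+-identityʳ c)) ⟩
      c                         ∎

  module _ {A : Set} (xs : List A) where

    ∑-allVecsOf-suc : ∀ k (f : Vec A (suc k) → ℕ) →
      ∑ (allVecsOf F xs (suc k)) f ≡ ∑[ a ← xs ] ∑[ v ← allVecsOf F xs k ] f (a ∷ v)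
    ∑-allVecsOf-suc k f = trans (∑-concatMap xs _ f) (∑-cong xs (λ a → ∑-map (allVecsOf F xs k) (a ∷_) f))

    ∑-allVecsOf-const : ∀ k c → ∑[ _ ← allVecsOf F xs k ] c ≡ length xs ^ k *ℕ c
    ∑-allVecsOf-const zero    c = refl
    ∑-allVecsOf-const (suc k) c = begin
      ∑[ _ ← allVecsOf F xs (suc k) ] c       ≡⟨ ∑-allVecsOf-suc k _ ⟩
      ∑[ _ ← xs ] ∑[ _ ← allVecsOf F xs k ] c ≡⟨ ∑-cong xs (λ _ → ∑-allVecsOf-const k c) ⟩
      ∑[ _ ← xs ] (length xs ^ k *ℕ c)        ≡⟨ ∑-const xs _ ⟩
      length xs *ℕ (length xs ^ k *ℕ c)       ≡⟨ sym (ℕ.*-assoc (length xs) _ c) ⟩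
      length xs ^ suc k *ℕ c                  ∎
      where open ≡-Reasoning

    allVecsOf-complete : (∀ a → a ∈ xs) → ∀ k (v : Vec A k) → v ∈ allVecsOf F xs k
    allVecsOf-complete complete zero    []      = here refl
    allVecsOf-complete complete (suc k) (a ∷ v) =
      ∈-concatMap⁺ (λ b → map (b ∷_) (allVecsOf F xs k))
                   (lose (complete a) (∈-map⁺ (a ∷_) (allVecsOf-complete complete k v)))

    allVecsOf-sifting : (_≟ᴬ_ : DecidableEquality A) → Sifting _≟ᴬ_ xs →
      ∀ k → Sifting (Vec.≡-dec _≟ᴬ_) (allVecsOf F xs k)
    allVecsOf-sifting _≟ᴬ_ sift zero    [] g = ℕ.+-identityʳ (g [])
    allVecsOf-sifting _≟ᴬ_ sift (suc k) (z ∷ zs) g = begin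
      ∑[ v ← allVecsOf F xs (suc k) ] when (does (Vec.≡-dec _≟ᴬ_ v (z ∷ zs))) (g v)
        ≡⟨ ∑-allVecsOf-suc k _ ⟩
      ∑[ a ← xs ] ∑[ v ← allVecsOf F xs k ] when (does (a ≟ᴬ z) ∧ does (Vec.≡-dec _≟ᴬ_ v zs)) (g (a ∷ v))
        ≡⟨ ∑-cong xs (λ a → ∑-cong (allVecsOf F xs k) (λ v → when-∧ (does (a ≟ᴬ z)) _ _)) ⟩
      ∑[ a ← xs ] ∑[ v ← allVecsOf F xs k ] when (does (a ≟ᴬ z)) (when (does (Vec.≡-dec _≟ᴬ_ v zs)) (g (a ∷ v)))
        ≡⟨ ∑-cong xs (λ a → ∑-when (allVecsOf F xs k) (does (a ≟ᴬ z)) _) ⟩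
      ∑[ a ← xs ] when (does (a ≟ᴬ z)) (∑[ v ← allVecsOf F xs k ] when (does (Vec.≡-dec _≟ᴬ_ v zs)) (g (a ∷ v)))
        ≡⟨ ∑-cong xs (λ a → cong (when (does (a ≟ᴬ z))) (allVecsOf-sifting _≟ᴬ_ sift k zs (λ v → g (a ∷ v)))) ⟩
      ∑[ a ← xs ] when (does (a ≟ᴬ z)) (g (a ∷ zs))
        ≡⟨ sift z (λ a → g (a ∷ zs)) ⟩
      g (z ∷ zs) ∎
      where open ≡-Reasoning

  elems-sifting : Sifting _≟_ elems
  elems-sifting = unique-complete⇒sifting _≟_ elems unique complete

  allVectors-sifting : ∀ k → Sifting (Vec.≡-dec _≟_) (allVectors F k)
  allVectors-sifting = allVecsOf-sifting elems _≟_ elems-sifting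

  allMats-sifting : ∀ m → Sifting (Vec.≡-dec (Vec.≡-dec _≟_)) (allMats F m)
  allMats-sifting m = allVecsOf-sifting (allVectors F m) _ (allVectors-sifting m) m

  allVectors-complete : ∀ k (v : Vector F k) → v ∈ allVectors F k
  allVectors-complete = allVecsOf-complete elems complete

  ∑-allVectors-const : ∀ k c → ∑[ _ ← allVectors F k ] c ≡ q ^ k *ℕ c
  ∑-allVectors-const = ∑-allVecsOf-const elems

  ∑-·-reindex : ∀ c → c ≢ 0# → (g : Carrier → ℕ) → ∑[ a ← elems ] g (c · a) ≡ ∑ elems g
  ∑-·-reindex c c≢0 g = begin
    ∑[ a ← elems ] g (c · a)
      ≡⟨ ∑-cong elems (λ a → sym (elems-sifting (c · a) g)) ⟩
    ∑[ a ← elems ] ∑[ b ← elems ] when (b ≐ c · a) (g b)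
      ≡⟨ ∑-comm elems elems _ ⟩
    ∑[ b ← elems ] ∑[ a ← elems ] when (b ≐ c · a) (g b)
      ≡⟨ ∑-cong elems (λ b → ∑-cong elems (λ a → cong (λ t → when t (g b)) (solved b a))) ⟩
    ∑[ b ← elems ] ∑[ a ← elems ] when (a ≐ c⁻¹ · b) (g b)
      ≡⟨ ∑-cong elems (λ b → elems-sifting (c⁻¹ · b) (λ _ → g b)) ⟩
    ∑ elems g ∎
    where
    open ≡-Reasoning
    c⁻¹ = inv c c≢0
    solved : ∀ b a → (b ≐ c · a) ≡ (a ≐ c⁻¹ · b)
    solved b a = does-⇔ (mk⇔ (λ b≡ca → trans (sym (inv-cancelˡ c c≢0 a)) (cong (c⁻¹ ·_) (sym b≡ca)))
                             (λ a≡c⁻¹b → trans (sym (inv-cancelʳ c c≢0 b)) (cong (c ·_) (sym a≡c⁻¹b))))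
                        (b ≟ (c · a)) (a ≟ (c⁻¹ · b))

  ∑-scaleV-reindex : ∀ k c → c ≢ 0# → (f : Vector F k → ℕ) →
    ∑[ u ← allVectors F k ] f (scaleV F c u) ≡ ∑ (allVectors F k) f
  ∑-scaleV-reindex zero    c c≢0 f = refl
  ∑-scaleV-reindex (suc k) c c≢0 f = begin
    ∑[ u ← allVectors F (suc k) ] f (scaleV F c u)
      ≡⟨ ∑-allVecsOf-suc elems k _ ⟩
    ∑[ a ← elems ] ∑[ u ← allVectors F k ] f (c · a ∷ scaleV F c u)
      ≡⟨ ∑-cong elems (λ a → ∑-scaleV-reindex k c c≢0 (λ v → f (c · a ∷ v))) ⟩
    ∑[ a ← elems ] ∑[ v ← allVectors F k ] f (c · a ∷ v)
      ≡⟨ ∑-·-reindex c c≢0 (λ b → ∑[ v ← allVectors F k ] f (b ∷ v)) ⟩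
    ∑[ b ← elems ] ∑[ v ← allVectors F k ] f (b ∷ v)
      ≡⟨ sym (∑-allVecsOf-suc elems k f) ⟩
    ∑ (allVectors F (suc k)) f ∎
    where open ≡-Reasoning

  ∑-affine-sift : ∀ a (a≢0 : a ≢ 0#) d c (X : Carrier → ℕ) →
    ∑[ y ← elems ] when (a · y + d ≐ c) (X y) ≡ X (inv a a≢0 · (c + - d))
  ∑-affine-sift a a≢0 d c X = trans (∑-cong elems solved) (elems-sifting _ X)
    where
    solved : ∀ y → when (a · y + d ≐ c) (X y) ≡ when (y ≐ inv a a≢0 · (c + - d)) (X y)
    solved y = cong (λ t → when t (X y)) (does-⇔ (affine-solution a a≢0 d c y) ((a · y + d) ≟ c) (y ≟ _))

  𝟙≢0 : Carrier → ℕ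
  𝟙≢0 a = when (not (a ≐ 0#)) 1

  #units : ℕ
  #units = ∑ elems 𝟙≢0

  #units+1≡q : #units +ℕ 1 ≡ q
  #units+1≡q = begin
    #units +ℕ 1
      ≡⟨ ℕ.+-comm #units 1 ⟩
    1 +ℕ #units
      ≡⟨ cong (_+ℕ #units) (sym (elems-sifting 0# (λ _ → 1))) ⟩
    ∑[ a ← elems ] when (a ≐ 0#) 1 +ℕ ∑[ a ← elems ] when (not (a ≐ 0#)) 1
      ≡⟨ sym (∑-split elems (_≐ 0#) (λ _ → 1)) ⟩
    ∑[ _ ← elems ] 1
      ≡⟨ ∑-const elems 1 ⟩
    q *ℕ 1
      ≡⟨ ℕ.*-identityʳ q ⟩
    q ∎
    where open ≡-Reasoning

  #units-nonZero : ℕ.NonZero #units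
  #units-nonZero = ℕ.≢-nonZero λ #units≡0 → ℕ.0≢1+n (begin
    0                                              ≡⟨ sym #units≡0 ⟩
    #units                                         ≡⟨ ∑-split elems (_≐ 1#) _ ⟩
    ∑[ a ← elems ] when (a ≐ 1#) (𝟙≢0 a) +ℕ others ≡⟨ cong (_+ℕ others) (elems-sifting 1# 𝟙≢0) ⟩
    when (not (1# ≐ 0#)) 1 +ℕ others               ≡⟨ cong (λ t → when (not t) 1 +ℕ others) 1≐0 ⟩
    suc others                                     ∎)
    where
    open ≡-Reasoning
    others : ℕ
    others = ∑[ a ← elems ] when (not (a ≐ 1#)) (𝟙≢0 a)

  -- Counting solutions of linear equations

  dot-zeroʳ : ∀ {k} (ξ x : Vector F k) → isZeroV F x ≡ true → dot F ξ x ≡ 0#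
  dot-zeroʳ []      []      _   = refl
  dot-zeroʳ (a ∷ ξ) (y ∷ x) x≡0 with y ≟ 0# | x≡0
  ... | yes refl | x'≡0 = trans (cong₂ _+_ (zeroʳ a) (dot-zeroʳ ξ x x'≡0)) (+-identityˡ 0#)
  ... | no  _    | ()

  dot-scaleˡ : ∀ {k} c (ξ x : Vector F k) → dot F (scaleV F c ξ) x ≡ c · dot F ξ x
  dot-scaleˡ c []      []      = sym (zeroʳ c)
  dot-scaleˡ c (a ∷ ξ) (y ∷ x) =
    trans (cong₂ _+_ (*-assoc c a y) (dot-scaleˡ c ξ x)) (sym (distribˡ c _ _))

  dot-scaleʳ : ∀ {k} c (ξ x : Vector F k) → dot F ξ (scaleV F c x) ≡ c · dot F ξ x
  dot-scaleʳ c []      []      = sym (zeroʳ c)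
  dot-scaleʳ c (a ∷ ξ) (y ∷ x) =
    trans (cong₂ _+_ (x∙yz≈y∙xz a c y) (dot-scaleʳ c ξ x))
          (sym (distribˡ c _ _))

  dot-addˡ : ∀ {k} (ξ η x : Vector F k) → dot F (zipWith _+_ ξ η) x ≡ dot F ξ x + dot F η x
  dot-addˡ []      []      []      = sym (+-identityˡ 0#)
  dot-addˡ (a ∷ ξ) (b ∷ η) (y ∷ x) = trans (cong₂ _+_ (distribʳ y a b) (dot-addˡ ξ η x))
    (+-interchange (a · y) (b · y) (dot F ξ x) (dot F η x))

  0·+ : ∀ y t → 0# · y + t ≡ t
  0·+ y t = trans (cong (_+ t) (zeroˡ y)) (+-identityˡ t)

  count-dot≡ : ∀ k (ξ : Vector F (suc k)) → isZeroV F ξ ≡ false → ∀ c →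
    ∑[ x ← allVectors F (suc k) ] when (dot F ξ x ≐ c) 1 ≡ q ^ k
  count-dot≡ k (a ∷ ξ) ξ≢0 c with a ≟ 0#
  count-dot≡ zero    (a ∷ []) () c | yes refl
  count-dot≡ (suc k) (a ∷ ξ) ξ≢0 c | yes refl = begin
    ∑[ x ← allVectors F (suc (suc k)) ] when (dot F (0# ∷ ξ) x ≐ c) 1
      ≡⟨ ∑-allVecsOf-suc elems (suc k) _ ⟩
    ∑[ y ← elems ] ∑[ x ← allVectors F (suc k) ] when (0# · y + dot F ξ x ≐ c) 1
      ≡⟨ ∑-cong elems (λ y → ∑-cong (allVectors F (suc k)) (λ x → cong (λ t → when (t ≐ c) 1) (0·+ y _))) ⟩
    ∑[ _ ← elems ] ∑[ x ← allVectors F (suc k) ] when (dot F ξ x ≐ c) 1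
      ≡⟨ ∑-cong elems (λ _ → count-dot≡ k ξ ξ≢0 c) ⟩
    ∑[ _ ← elems ] (q ^ k)
      ≡⟨ ∑-const elems _ ⟩
    q ^ suc k ∎
    where open ≡-Reasoning
  count-dot≡ k (a ∷ ξ) ξ≢0 c | no a≢0 = begin
    ∑[ x ← allVectors F (suc k) ] when (dot F (a ∷ ξ) x ≐ c) 1
      ≡⟨ ∑-allVecsOf-suc elems k _ ⟩
    ∑[ y ← elems ] ∑[ x ← allVectors F k ] when (a · y + dot F ξ x ≐ c) 1
      ≡⟨ ∑-comm elems (allVectors F k) _ ⟩
    ∑[ x ← allVectors F k ] ∑[ y ← elems ] when (a · y + dot F ξ x ≐ c) 1
      ≡⟨ ∑-cong (allVectors F k) (λ x → ∑-affine-sift a a≢0 _ c (λ _ → 1)) ⟩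
    ∑[ _ ← allVectors F k ] 1
      ≡⟨ ∑-allVectors-const k 1 ⟩
    q ^ k *ℕ 1
      ≡⟨ ℕ.*-identityʳ _ ⟩
    q ^ k ∎
    where open ≡-Reasoning

  Independent : ∀ {k} → Vector F k → Vector F k → Set
  Independent ξ η = isZeroV F ξ ≡ false × (∀ l → η ≢ scaleV F l ξ)

  ¬independent-F¹ : (ξ η : Vector F 1) → ¬ Independent ξ η
  ¬independent-F¹ (a ∷ []) (b ∷ []) (ξ≢0 , η∉⟨ξ⟩) with a ≟ 0#
  ¬independent-F¹ (a ∷ []) (b ∷ []) (() , _) | yes _
  ¬independent-F¹ (a ∷ []) (b ∷ []) (_ , η∉⟨ξ⟩) | no a≢0 =
    η∉⟨ξ⟩ (b · inv a a≢0) (cong (_∷ []) (sym (·-inv-cancelʳ a a≢0 b)))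

  ∉span-tail : ∀ {k} {ξ η : Vector F k} →
    (∀ l → 0# ∷ η ≢ scaleV F l (0# ∷ ξ)) → ∀ l → η ≢ scaleV F l ξ
  ∉span-tail η∉⟨ξ⟩ l η≡lξ = η∉⟨ξ⟩ l (cong₂ _∷_ (sym (zeroʳ l)) η≡lξ)

  +-neg-·-cancel : ∀ a t b → (a + (- t) · b) + t · b ≡ a
  +-neg-·-cancel a t b = begin
    (a + (- t) · b) + t · b ≡⟨ +-assoc a _ _ ⟩
    a + ((- t) · b + t · b) ≡⟨ cong (a +_) (sym (distribʳ b (- t) t)) ⟩
    a + (- t + t) · b       ≡⟨ cong (λ s → a + s · b) (-‿inverseˡ t) ⟩
    a + 0# · b              ≡⟨ cong (a +_) (zeroˡ b) ⟩
    a + 0#                  ≡⟨ +-identityʳ a ⟩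
    a                       ∎
    where open ≡-Reasoning

  difference-zero⇒≡ : ∀ {k} t (η ξ : Vector F k) →
    isZeroV F (zipWith _+_ η (scaleV F (- t) ξ)) ≡ true → η ≡ scaleV F t ξ
  difference-zero⇒≡ t []      []      _ = refl
  difference-zero⇒≡ t (b ∷ η) (a ∷ ξ) ζ≡0 with (b + (- t) · a) ≟ 0# | ζ≡0
  ... | yes b-ta≡0 | ζ'≡0 =
    cong₂ _∷_ (trans (sym (+-neg-·-cancel b t a)) (trans (cong (_+ t · a) b-ta≡0) (+-identityˡ _)))
              (difference-zero⇒≡ t η ξ ζ'≡0)
  ... | no _       | ()

  eliminate : ∀ {k} a → a ≢ 0# → Carrier → Vector F k → Vector F k → Vector F k
  eliminate a a≢0 b ξ η = zipWith _+_ η (scaleV F (- (b · inv a a≢0)) ξ)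

  dot-eliminate : ∀ {k} a (a≢0 : a ≢ 0#) b (ξ η x : Vector F k) →
    b · (inv a a≢0 · (0# + - dot F ξ x)) + dot F η x ≡ dot F (eliminate a a≢0 b ξ η) x
  dot-eliminate a a≢0 b ξ η x = begin
    b · (a⁻¹ · (0# + - dot F ξ x)) + dot F η x ≡⟨ cong (λ s → b · (a⁻¹ · s) + dot F η x) (+-identityˡ _) ⟩
    b · (a⁻¹ · (- dot F ξ x)) + dot F η x      ≡⟨ cong (λ s → b · s + dot F η x) (sym (-‿distribʳ-* a⁻¹ _)) ⟩
    b · (- (a⁻¹ · dot F ξ x)) + dot F η x      ≡⟨ cong (_+ dot F η x) (sym (-‿distribʳ-* b _)) ⟩
    - (b · (a⁻¹ · dot F ξ x)) + dot F η x      ≡⟨ cong (λ s → - s + dot F η x) (sym (*-assoc b a⁻¹ _)) ⟩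
    - (μ · dot F ξ x) + dot F η x              ≡⟨ cong (_+ dot F η x) (-‿distribˡ-* μ _) ⟩
    (- μ) · dot F ξ x + dot F η x              ≡⟨ +-comm _ _ ⟩
    dot F η x + (- μ) · dot F ξ x              ≡⟨ cong (dot F η x +_) (sym (dot-scaleˡ (- μ) ξ x)) ⟩
    dot F η x + dot F (scaleV F (- μ) ξ) x     ≡⟨ sym (dot-addˡ η _ x) ⟩
    dot F (eliminate a a≢0 b ξ η) x            ∎
    where
    open ≡-Reasoning
    a⁻¹ = inv a a≢0
    μ = b · a⁻¹

  eliminate-nonzero : ∀ {k} a (a≢0 : a ≢ 0#) b (ξ η : Vector F k) →
    (∀ l → b ∷ η ≢ scaleV F l (a ∷ ξ)) → isZeroV F (eliminate a a≢0 b ξ η) ≡ false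
  eliminate-nonzero a a≢0 b ξ η bη∉⟨aξ⟩ with isZeroV F (eliminate a a≢0 b ξ η) in ζ≡0
  ... | false = refl
  ... | true  = ⊥-elim (bη∉⟨aξ⟩ μ (cong₂ _∷_ (sym (·-inv-cancelʳ a a≢0 b)) (difference-zero⇒≡ μ η ξ ζ≡0)))
    where μ = b · inv a a≢0

  count-dot≡0-dot≡0 : ∀ k (ξ η : Vector F (suc (suc k))) → Independent ξ η →
    ∑[ x ← allVectors F (suc (suc k)) ] when (dot F ξ x ≐ 0#) (when (dot F η x ≐ 0#) 1) ≡ q ^ k
  count-dot≡0-dot≡0 k (a ∷ ξ) (b ∷ η) ind with a ≟ 0# | b ≟ 0#
  ... | no a≢0 | _ = begin
    ∑[ x ← allVectors F (suc (suc k)) ] when (dot F (a ∷ ξ) x ≐ 0#) (when (dot F (b ∷ η) x ≐ 0#) 1)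
      ≡⟨ ∑-allVecsOf-suc elems (suc k) _ ⟩
    ∑[ y ← elems ] ∑[ x ← allVectors F (suc k) ] when (a · y + dot F ξ x ≐ 0#) (when (b · y + dot F η x ≐ 0#) 1)
      ≡⟨ ∑-comm elems (allVectors F (suc k)) _ ⟩
    ∑[ x ← allVectors F (suc k) ] ∑[ y ← elems ] when (a · y + dot F ξ x ≐ 0#) (when (b · y + dot F η x ≐ 0#) 1)
      ≡⟨ ∑-cong (allVectors F (suc k)) (λ x → ∑-affine-sift a a≢0 _ 0# (λ y → when (b · y + dot F η x ≐ 0#) 1)) ⟩
    ∑[ x ← allVectors F (suc k) ] when (b · (inv a a≢0 · (0# + - dot F ξ x)) + dot F η x ≐ 0#) 1
      ≡⟨ ∑-cong (allVectors F (suc k)) (λ x → cong (λ t → when (t ≐ 0#) 1) (dot-eliminate a a≢0 b ξ η x)) ⟩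
    ∑[ x ← allVectors F (suc k) ] when (dot F (eliminate a a≢0 b ξ η) x ≐ 0#) 1
      ≡⟨ count-dot≡ k (eliminate a a≢0 b ξ η) (eliminate-nonzero a a≢0 b ξ η (proj₂ ind)) 0# ⟩
    q ^ k ∎
    where open ≡-Reasoning
  ... | yes refl | no b≢0 = begin
    ∑[ x ← allVectors F (suc (suc k)) ] when (dot F (0# ∷ ξ) x ≐ 0#) (when (dot F (b ∷ η) x ≐ 0#) 1)
      ≡⟨ ∑-allVecsOf-suc elems (suc k) _ ⟩
    ∑[ y ← elems ] ∑[ x ← allVectors F (suc k) ] when (0# · y + dot F ξ x ≐ 0#) (when (b · y + dot F η x ≐ 0#) 1)
      ≡⟨ ∑-cong elems (λ y → ∑-cong (allVectors F (suc k)) (λ x → cong (λ t → when (t ≐ 0#) _) (0·+ y _))) ⟩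
    ∑[ y ← elems ] ∑[ x ← allVectors F (suc k) ] when (dot F ξ x ≐ 0#) (when (b · y + dot F η x ≐ 0#) 1)
      ≡⟨ ∑-comm elems (allVectors F (suc k)) _ ⟩
    ∑[ x ← allVectors F (suc k) ] ∑[ y ← elems ] when (dot F ξ x ≐ 0#) (when (b · y + dot F η x ≐ 0#) 1)
      ≡⟨ ∑-cong (allVectors F (suc k)) (λ x → ∑-when elems (dot F ξ x ≐ 0#) _) ⟩
    ∑[ x ← allVectors F (suc k) ] when (dot F ξ x ≐ 0#) (∑[ y ← elems ] when (b · y + dot F η x ≐ 0#) 1)
      ≡⟨ ∑-cong (allVectors F (suc k)) (λ x → cong (when (dot F ξ x ≐ 0#)) (∑-affine-sift b b≢0 _ 0# (λ _ → 1))) ⟩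
    ∑[ x ← allVectors F (suc k) ] when (dot F ξ x ≐ 0#) 1
      ≡⟨ count-dot≡ k ξ (proj₁ ind) 0# ⟩
    q ^ k ∎
    where open ≡-Reasoning
  count-dot≡0-dot≡0 zero    (a ∷ ξ) (b ∷ η) ind | yes refl | yes refl =
    ⊥-elim (¬independent-F¹ ξ η (proj₁ ind , ∉span-tail (proj₂ ind)))
  count-dot≡0-dot≡0 (suc k) (a ∷ ξ) (b ∷ η) ind | yes refl | yes refl = begin
    ∑[ x ← allVectors F (suc (suc (suc k))) ] when (dot F (0# ∷ ξ) x ≐ 0#) (when (dot F (0# ∷ η) x ≐ 0#) 1)
      ≡⟨ ∑-allVecsOf-suc elems (suc (suc k)) _ ⟩
    ∑[ y ← elems ] ∑[ x ← allVectors F (suc (suc k)) ] when (0# · y + dot F ξ x ≐ 0#) (when (0# · y + dot F η x ≐ 0#) 1)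
      ≡⟨ ∑-cong elems (λ y → ∑-cong (allVectors F (suc (suc k))) (λ x →
           cong₂ (λ s t → when (s ≐ 0#) (when (t ≐ 0#) 1)) (0·+ y _) (0·+ y _))) ⟩
    ∑[ _ ← elems ] ∑[ x ← allVectors F (suc (suc k)) ] when (dot F ξ x ≐ 0#) (when (dot F η x ≐ 0#) 1)
      ≡⟨ ∑-cong elems (λ _ → count-dot≡0-dot≡0 k ξ η (proj₁ ind , ∉span-tail (proj₂ ind))) ⟩
    ∑[ _ ← elems ] (q ^ k)
      ≡⟨ ∑-const elems _ ⟩
    q ^ suc k ∎
    where open ≡-Reasoning

  ∑-normalised-suc : ∀ k (P : Vector F (suc k) → ℕ) →
    ∑[ u ← allVectors F (suc k) ] when (normalised F u) (P u)
      ≡ ∑[ u ← allVectors F k ] when (normalised F u) (P (0# ∷ u)) +ℕ ∑[ u ← allVectors F k ] P (1# ∷ u)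
  ∑-normalised-suc k P = begin
    ∑[ u ← allVectors F (suc k) ] when (normalised F u) (P u)
      ≡⟨ ∑-allVecsOf-suc elems k _ ⟩
    ∑[ a ← elems ] X a
      ≡⟨ ∑-cong elems by-head ⟩
    ∑[ a ← elems ] (when (a ≐ 0#) (X 0#) +ℕ when (a ≐ 1#) B)
      ≡⟨ ∑-+ elems _ _ ⟩
    ∑[ a ← elems ] when (a ≐ 0#) (X 0#) +ℕ ∑[ a ← elems ] when (a ≐ 1#) B
      ≡⟨ cong₂ _+ℕ_ (elems-sifting 0# _) (elems-sifting 1# _) ⟩
    X 0# +ℕ B
      ≡⟨ cong (_+ℕ B) leading-zero ⟩
    ∑[ u ← allVectors F k ] when (normalised F u) (P (0# ∷ u)) +ℕ B ∎
    where
    open ≡-Reasoning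
    X : Carrier → ℕ
    X a = ∑[ u ← allVectors F k ] when (normalised F (a ∷ u)) (P (a ∷ u))
    B : ℕ
    B = ∑[ u ← allVectors F k ] P (1# ∷ u)
    leading-zero : X 0# ≡ ∑[ u ← allVectors F k ] when (normalised F u) (P (0# ∷ u))
    leading-zero rewrite ≐-refl 0# = refl
    by-head : ∀ a → X a ≡ when (a ≐ 0#) (X 0#) +ℕ when (a ≐ 1#) B
    by-head a with a ≟ 0#
    ... | yes refl = sym (begin
      X 0# +ℕ when (0# ≐ 1#) B ≡⟨ cong (λ b → X 0# +ℕ when b B) 0≐1 ⟩
      X 0# +ℕ 0                ≡⟨ ℕ.+-identityʳ _ ⟩
      X 0#                     ≡⟨ leading-zero ⟩
      _                        ∎)
    ... | no  _    = trans (∑-when (allVectors F k) (a ≐ 1#) _)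
                           (when-congʳ (a ≐ 1#) λ a≐1 → cong (λ b → ∑[ u ← allVectors F k ] P (b ∷ u)) (≐-true a≐1))

  ∑-normalised≡projCount : ∀ n → ∑[ u ← allVectors F (suc n) ] when (normalised F u) 1 ≡ projCount F n
  ∑-normalised≡projCount zero    = ∑-normalised-suc 0 (λ _ → 1)
  ∑-normalised≡projCount (suc n) = begin
    ∑[ u ← allVectors F (suc (suc n)) ] when (normalised F u) 1
      ≡⟨ ∑-normalised-suc (suc n) _ ⟩
    ∑[ u ← allVectors F (suc n) ] when (normalised F u) 1 +ℕ ∑[ _ ← allVectors F (suc n) ] 1
      ≡⟨ cong₂ _+ℕ_ (∑-normalised≡projCount n) (∑-allVectors-const (suc n) 1) ⟩
    projCount F n +ℕ q ^ suc n *ℕ 1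
      ≡⟨ cong (projCount F n +ℕ_) (ℕ.*-identityʳ _) ⟩
    projCount F n +ℕ q ^ suc n
      ≡⟨ ℕ.+-comm (projCount F n) _ ⟩
    projCount F (suc n) ∎
    where open ≡-Reasoning

  ScaleInvariant : ∀ {k} → (Vector F k → ℕ) → Set
  ScaleInvariant P = ∀ c v → c ≢ 0# → P (scaleV F c v) ≡ P v

  ∑-leading-unit : ∀ k (P : Vector F (suc k) → ℕ) → ScaleInvariant P → ∀ a → a ≢ 0# →
    ∑[ v ← allVectors F k ] P (a ∷ v) ≡ ∑[ u ← allVectors F k ] P (1# ∷ u)
  ∑-leading-unit k P invariant a a≢0 = begin
    ∑[ v ← allVectors F k ] P (a ∷ v)
      ≡⟨ sym (∑-scaleV-reindex k a a≢0 (λ v → P (a ∷ v))) ⟩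
    ∑[ u ← allVectors F k ] P (a ∷ scaleV F a u)
      ≡⟨ ∑-cong (allVectors F k) (λ u → cong (λ b → P (b ∷ scaleV F a u)) (sym (*-identityʳ a))) ⟩
    ∑[ u ← allVectors F k ] P (scaleV F a (1# ∷ u))
      ≡⟨ ∑-cong (allVectors F k) (λ u → invariant a (1# ∷ u) a≢0) ⟩
    ∑[ u ← allVectors F k ] P (1# ∷ u) ∎
    where open ≡-Reasoning

  ∑-nonzero≡#units*∑-normalised : ∀ k (P : Vector F k → ℕ) → ScaleInvariant P →
    ∑[ v ← allVectors F k ] when (not (isZeroV F v)) (P v)
      ≡ #units *ℕ ∑[ u ← allVectors F k ] when (normalised F u) (P u)
  ∑-nonzero≡#units*∑-normalised zero    P invariant = sym (ℕ.*-zeroʳ #units)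
  ∑-nonzero≡#units*∑-normalised (suc k) P invariant = begin
    ∑[ v ← allVectors F (suc k) ] when (not (isZeroV F v)) (P v)
      ≡⟨ ∑-allVecsOf-suc elems k _ ⟩
    ∑[ a ← elems ] Y a
      ≡⟨ ∑-cong elems by-head ⟩
    ∑[ a ← elems ] (when (a ≐ 0#) (Y 0#) +ℕ when (not (a ≐ 0#)) B)
      ≡⟨ ∑-+ elems _ _ ⟩
    ∑[ a ← elems ] when (a ≐ 0#) (Y 0#) +ℕ ∑[ a ← elems ] when (not (a ≐ 0#)) B
      ≡⟨ cong₂ _+ℕ_ (elems-sifting 0# _) units ⟩
    Y 0# +ℕ #units *ℕ B
      ≡⟨ cong (_+ℕ #units *ℕ B) leading-zero ⟩
    #units *ℕ A +ℕ #units *ℕ B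
      ≡⟨ sym (ℕ.*-distribˡ-+ #units A B) ⟩
    #units *ℕ (A +ℕ B)
      ≡⟨ cong (#units *ℕ_) (sym (∑-normalised-suc k P)) ⟩
    #units *ℕ ∑[ u ← allVectors F (suc k) ] when (normalised F u) (P u) ∎
    where
    open ≡-Reasoning
    Y : Carrier → ℕ
    Y a = ∑[ v ← allVectors F k ] when (not (isZeroV F (a ∷ v))) (P (a ∷ v))
    A B : ℕ
    A = ∑[ u ← allVectors F k ] when (normalised F u) (P (0# ∷ u))
    B = ∑[ u ← allVectors F k ] P (1# ∷ u)
    zero-head : Y 0# ≡ ∑[ v ← allVectors F k ] when (not (isZeroV F v)) (P (0# ∷ v))
    zero-head rewrite ≐-refl 0# = refl
    leading-zero : Y 0# ≡ #units *ℕ A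
    leading-zero = trans zero-head $
      ∑-nonzero≡#units*∑-normalised k (λ v → P (0# ∷ v)) λ c v c≢0 →
        trans (cong (λ b → P (b ∷ scaleV F c v)) (sym (zeroʳ c))) (invariant c (0# ∷ v) c≢0)
    units : ∑[ a ← elems ] when (not (a ≐ 0#)) B ≡ #units *ℕ B
    units = begin
      ∑[ a ← elems ] when (not (a ≐ 0#)) B        ≡⟨ ∑-cong elems (λ a → when≡*when1 (not (a ≐ 0#)) B) ⟩
      ∑[ a ← elems ] (B *ℕ when (not (a ≐ 0#)) 1) ≡⟨ ∑-*ˡ elems B _ ⟩
      B *ℕ #units                                 ≡⟨ ℕ.*-comm B #units ⟩
      #units *ℕ B                                 ∎
    by-head : ∀ a → Y a ≡ when (a ≐ 0#) (Y 0#) +ℕ when (not (a ≐ 0#)) B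
    by-head a with a ≟ 0#
    ... | yes refl = sym (trans (ℕ.+-identityʳ _) zero-head)
    ... | no  a≢0  = ∑-leading-unit k P invariant a a≢0

  -- With I the count in question, (q - 1) I = #{x ≠ 0 | ξ x = 0, η x ≠ 0} = q^(k+1) - q^k.
  count-normalised-dot≡0-dot≢0 : ∀ k (ξ η : Vector F (suc (suc k))) → Independent ξ η →
    ∑[ x ← allVectors F (suc (suc k)) ] when (normalised F x) (when (dot F ξ x ≐ 0#) (𝟙≢0 (dot F η x))) ≡ q ^ k
  count-normalised-dot≡0-dot≢0 k ξ η ind =
    ℕ.*-cancelˡ-≡ I (q ^ k) #units {{#units-nonZero}} $ ℕ.+-cancelʳ-≡ (q ^ k) _ _ $ begin
    #units *ℕ I +ℕ q ^ k          ≡⟨ cong₂ _+ℕ_ (sym S≡#units*I) (sym (count-dot≡0-dot≡0 k ξ η ind)) ⟩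
    S +ℕ Z                        ≡⟨ ℕ.+-comm S Z ⟩
    Z +ℕ S                        ≡⟨ Z+S≡q^[k+1] ⟩
    q *ℕ q ^ k                    ≡⟨ cong (_*ℕ q ^ k) (sym #units+1≡q) ⟩
    (#units +ℕ 1) *ℕ q ^ k        ≡⟨ ℕ.*-distribʳ-+ (q ^ k) #units 1 ⟩
    #units *ℕ q ^ k +ℕ 1 *ℕ q ^ k ≡⟨ cong (#units *ℕ q ^ k +ℕ_) (ℕ.*-identityˡ _) ⟩
    #units *ℕ q ^ k +ℕ q ^ k      ∎
    where
    open ≡-Reasoning
    m = suc (suc k)
    P : Vector F m → ℕ
    P x = when (dot F ξ x ≐ 0#) (𝟙≢0 (dot F η x))
    I S Z : ℕ
    I = ∑[ x ← allVectors F m ] when (normalised F x) (P x)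
    S = ∑ (allVectors F m) P
    Z = ∑[ x ← allVectors F m ] when (dot F ξ x ≐ 0#) (when (dot F η x ≐ 0#) 1)

    Z+S≡q^[k+1] : Z +ℕ S ≡ q ^ suc k
    Z+S≡q^[k+1] = begin
      Z +ℕ S                                        ≡⟨ sym (∑-+ (allVectors F m) _ P) ⟩
      ∑[ x ← allVectors F m ] (when (dot F ξ x ≐ 0#) (when (dot F η x ≐ 0#) 1) +ℕ P x)
        ≡⟨ ∑-cong (allVectors F m) (λ x → sym (when-+ (dot F ξ x ≐ 0#) _ _)) ⟩
      ∑[ x ← allVectors F m ] when (dot F ξ x ≐ 0#) (when (dot F η x ≐ 0#) 1 +ℕ 𝟙≢0 (dot F η x))
        ≡⟨ ∑-cong (allVectors F m) (λ x → cong (when (dot F ξ x ≐ 0#)) (when+when-not (dot F η x ≐ 0#) 1)) ⟩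
      ∑[ x ← allVectors F m ] when (dot F ξ x ≐ 0#) 1 ≡⟨ count-dot≡ (suc k) ξ (proj₁ ind) 0# ⟩
      q ^ suc k                                     ∎

    P-vanishes-at-0 : ∀ x → when (not (isZeroV F x)) (P x) ≡ P x
    P-vanishes-at-0 x with isZeroV F x in x≡0
    ... | false = refl
    ... | true rewrite dot-zeroʳ ξ x x≡0 | dot-zeroʳ η x x≡0 | ≐-refl 0# = refl

    P-invariant : ScaleInvariant P
    P-invariant c x c≢0
      rewrite dot-scaleʳ c ξ x | dot-scaleʳ c η x | ·≐0 c (dot F ξ x) c≢0 | ·≐0 c (dot F η x) c≢0 = refl

    S≡#units*I : S ≡ #units *ℕ I
    S≡#units*I = trans (sym (∑-cong (allVectors F m) P-vanishes-at-0)) (∑-nonzero≡#units*∑-normalised m P P-invariant)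

  normalised⇒nonzero : ∀ {k} (v : Vector F k) → normalised F v ≡ true → isZeroV F v ≡ false
  normalised⇒nonzero []      ()
  normalised⇒nonzero (a ∷ v) v-normalised with a ≟ 0#
  ... | yes _ = normalised⇒nonzero v v-normalised
  ... | no  _ = refl

  isLeftEigen-true : ∀ {m} (M : Mat F m) ξ → isLeftEigen F M ξ ≡ true →
    Σ Carrier λ l → rowMul F ξ M ≡ scaleV F l ξ
  isLeftEigen-true M ξ eigen with l , ξM≐lξ ← any-true _ elems eigen = l , does-true (Vec.≡-dec _≟_ _ _) ξM≐lξ

  isLeftEigen-false : ∀ {m} (M : Mat F m) ξ → isLeftEigen F M ξ ≡ false → ∀ l → rowMul F ξ M ≢ scaleV F l ξ
  isLeftEigen-false M ξ not-eigen l ξM≡lξ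
    with () ← trans (sym not-eigen) (any-intro _ (complete l) (dec-true (Vec.≡-dec _≟_ _ _) ξM≡lξ))

  count-normalised-dot≡0-rowMul≢0 : ∀ n (M : Mat F (suc n)) (ξ : Vector F (suc n)) → normalised F ξ ≡ true →
    ∑[ x ← allVectors F (suc n) ] when (normalised F x) (when (dot F ξ x ≐ 0#) (𝟙≢0 (dot F (rowMul F ξ M) x)))
      ≡ when (not (isLeftEigen F M ξ)) (q ^ (n ∸ 1))
  count-normalised-dot≡0-rowMul≢0 n M ξ ξ-normalised with isLeftEigen F M ξ in eigen
  ... | true  = ∑-zero (allVectors F (suc n)) vanishes
    where
    l = proj₁ (isLeftEigen-true M ξ eigen)
    vanishes : ∀ x → when (normalised F x) (when (dot F ξ x ≐ 0#) (𝟙≢0 (dot F (rowMul F ξ M) x))) ≡ 0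
    vanishes x rewrite proj₂ (isLeftEigen-true M ξ eigen) | dot-scaleˡ l ξ x with dot F ξ x ≟ 0#
    ... | yes ξx≡0 rewrite ξx≡0 | zeroʳ l | ≐-refl 0# = when-zero (normalised F x)
    ... | no  _    = when-zero (normalised F x)
  ... | false = off-eigen n M ξ (normalised⇒nonzero ξ ξ-normalised , isLeftEigen-false M ξ eigen)
    where
    off-eigen : ∀ n (M : Mat F (suc n)) ξ → Independent ξ (rowMul F ξ M) →
      ∑[ x ← allVectors F (suc n) ] when (normalised F x) (when (dot F ξ x ≐ 0#) (𝟙≢0 (dot F (rowMul F ξ M) x)))
        ≡ q ^ (n ∸ 1)
    off-eigen zero    M ξ ind = ⊥-elim (¬independent-F¹ ξ (rowMul F ξ M) ind)
    off-eigen (suc k) M ξ ind = count-normalised-dot≡0-dot≢0 k ξ (rowMul F ξ M) ind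

  -- Λ₁ is parametrised by normalised flags

  scaleV-one : ∀ {k} (v : Vector F k) → scaleV F 1# v ≡ v
  scaleV-one v = trans (Vec.map-cong *-identityˡ v) (Vec.map-id v)

  scaleV-zero : ∀ {k} (v : Vector F k) → isZeroV F (scaleV F 0# v) ≡ true
  scaleV-zero []      = refl
  scaleV-zero (a ∷ v) rewrite zeroˡ a | ≐-refl 0# = scaleV-zero v

  scaleV-zero⇒zero : ∀ {k} c (v : Vector F k) → isZeroV F v ≡ false → isZeroV F (scaleV F c v) ≡ true → c ≡ 0#
  scaleV-zero⇒zero c (a ∷ v) v≢0 cv≡0 with a ≟ 0# | (c · a) ≟ 0# | cv≡0
  ... | yes _   | yes _    | cv'≡0 = scaleV-zero⇒zero c v v≢0 cv'≡0
  ... | no  a≢0 | yes ca≡0 | _     = ·-zero⇒zeroʳ a a≢0 (trans (*-comm a c) ca≡0)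

  scaleV-nonzero : ∀ {k} c (v : Vector F k) → c ≢ 0# → isZeroV F v ≡ false → isZeroV F (scaleV F c v) ≡ false
  scaleV-nonzero c v c≢0 v≢0 with isZeroV F (scaleV F c v) in cv≡0
  ... | false = refl
  ... | true  = ⊥-elim (c≢0 (scaleV-zero⇒zero c v v≢0 cv≡0))

  scaleV-cancelʳ : ∀ {k} c d (v : Vector F k) → isZeroV F v ≡ false → scaleV F c v ≡ scaleV F d v → c ≡ d
  scaleV-cancelʳ c d (a ∷ v) v≢0 cv≡dv with a ≟ 0#
  ... | yes _   = scaleV-cancelʳ c d v v≢0 (Vec.∷-injectiveʳ cv≡dv)
  ... | no  a≢0 = ·-cancelˡ a a≢0 (trans (*-comm a c) (trans (Vec.∷-injectiveˡ cv≡dv) (*-comm d a)))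

  normalised-scaleV : ∀ {k} c (ξ : Vector F k) → c ≢ 0# → normalised F ξ ≡ true →
    normalised F (scaleV F c ξ) ≡ (c ≐ 1#)
  normalised-scaleV c (a ∷ ξ) c≢0 ξ-normalised with a ≟ 0#
  ... | yes refl rewrite zeroʳ c | ≐-refl 0# = normalised-scaleV c ξ c≢0 ξ-normalised
  ... | no  _    rewrite ≐-true ξ-normalised | *-identityʳ c with c ≟ 0#
  ...   | yes c≡0 = ⊥-elim (c≢0 c≡0)
  ...   | no  _   = refl

  normalise : ∀ {k} (ξ : Vector F k) → isZeroV F ξ ≡ false →
    Σ Carrier λ c → c ≢ 0# × normalised F (scaleV F c ξ) ≡ true
  normalise (a ∷ ξ) ξ≢0 with a ≟ 0#
  ... | yes refl with c , c≢0 , cξ-normalised ← normalise ξ ξ≢0 = c , c≢0 , leading-zero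
    where
    leading-zero : normalised F (scaleV F c (0# ∷ ξ)) ≡ true
    leading-zero rewrite zeroʳ c | ≐-refl 0# = cξ-normalised
  ... | no  a≢0 = inv a a≢0 , inv≢0 a a≢0 , leading-one
    where
    leading-one : normalised F (scaleV F (inv a a≢0) (a ∷ ξ)) ≡ true
    leading-one rewrite inverseˡ a a≢0 | 1≐0 = ≐-refl 1#

  -- `outer` for vectors of possibly different lengths, so that one can induct on x.
  rows : ∀ {k m} → Vector F k → Vector F m → Vec (Vector F m) k
  rows x ξ = Data.Vec.map (λ a → scaleV F a ξ) x

  rows-scale : ∀ {k m} c d (x : Vector F k) (ξ : Vector F m) → d · c ≡ 1# →
    rows (scaleV F d x) (scaleV F c ξ) ≡ rows x ξ
  rows-scale c d []      ξ dc≡1 = refl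
  rows-scale c d (a ∷ x) ξ dc≡1 = cong₂ _∷_ row (rows-scale c d x ξ dc≡1)
    where
    row : scaleV F (d · a) (scaleV F c ξ) ≡ scaleV F a ξ
    row = trans (sym (Vec.map-∘ _ _ ξ)) (Vec.map-cong (λ b → begin
      (d · a) · (c · b) ≡⟨ ·-interchange d a c b ⟩
      (d · c) · (a · b) ≡⟨ cong (_· (a · b)) dc≡1 ⟩
      1# · (a · b)      ≡⟨ *-identityˡ _ ⟩
      a · b             ∎) ξ)
      where open ≡-Reasoning

  rows-cancelʳ : ∀ {k m} (x y : Vector F k) (ξ : Vector F m) → isZeroV F ξ ≡ false → rows x ξ ≡ rows y ξ → x ≡ y
  rows-cancelʳ []      []      ξ ξ≢0 _ = refl
  rows-cancelʳ (a ∷ x) (b ∷ y) ξ ξ≢0 xξ≡yξ =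
    cong₂ _∷_ (scaleV-cancelʳ a b ξ ξ≢0 (Vec.∷-injectiveˡ xξ≡yξ))
              (rows-cancelʳ x y ξ ξ≢0 (Vec.∷-injectiveʳ xξ≡yξ))

  zero-row⇒zero : ∀ {m} b (ξ η : Vector F m) → normalised F η ≡ true → scaleV F 0# ξ ≡ scaleV F b η → b ≡ 0#
  zero-row⇒zero b ξ η η-n 0ξ≡bη =
    scaleV-zero⇒zero b η (normalised⇒nonzero η η-n) (subst (λ v → isZeroV F v ≡ true) 0ξ≡bη (scaleV-zero ξ))

  rows-injective : ∀ {k m} (x y : Vector F k) (ξ η : Vector F m) →
    normalised F x ≡ true → normalised F y ≡ true → normalised F ξ ≡ true → normalised F η ≡ true →
    rows x ξ ≡ rows y η → x ≡ y × ξ ≡ η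
  rows-injective (a ∷ x) (b ∷ y) ξ η x-n y-n ξ-n η-n xξ≡yη with a ≟ 0# | b ≟ 0#
  ... | yes refl | yes refl with x≡y , ξ≡η ← rows-injective x y ξ η x-n y-n ξ-n η-n (Vec.∷-injectiveʳ xξ≡yη) =
    cong (0# ∷_) x≡y , ξ≡η
  ... | yes refl | no b≢0 =
    ⊥-elim (b≢0 (zero-row⇒zero b ξ η η-n (Vec.∷-injectiveˡ xξ≡yη)))
  ... | no a≢0   | yes refl =
    ⊥-elim (a≢0 (zero-row⇒zero a η ξ ξ-n (sym (Vec.∷-injectiveˡ xξ≡yη))))
  ... | no _     | no _ = cong₂ _∷_ (trans a≡1 (sym b≡1)) (rows-cancelʳ x y ξ (normalised⇒nonzero ξ ξ-n) xξ≡yξ) , ξ≡η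
    where
    open ≡-Reasoning
    a≡1 = ≐-true x-n
    b≡1 = ≐-true y-n
    ξ≡η : ξ ≡ η
    ξ≡η = begin
      ξ             ≡⟨ sym (scaleV-one ξ) ⟩
      scaleV F 1# ξ ≡⟨ cong (λ c → scaleV F c ξ) (sym a≡1) ⟩
      scaleV F a ξ  ≡⟨ Vec.∷-injectiveˡ xξ≡yη ⟩
      scaleV F b η  ≡⟨ cong (λ c → scaleV F c η) b≡1 ⟩
      scaleV F 1# η ≡⟨ scaleV-one η ⟩
      η             ∎
    xξ≡yξ : rows x ξ ≡ rows y ξ
    xξ≡yξ = subst (λ ζ → rows x ξ ≡ rows y ζ) (sym ξ≡η) (Vec.∷-injectiveʳ xξ≡yη)

  normalised-++ : ∀ {k l} (u : Vector F k) (v : Vector F l) →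
    normalised F (u Data.Vec.++ v) ≡ (if isZeroV F u then normalised F v else normalised F u)
  normalised-++ []      v = refl
  normalised-++ (a ∷ u) v with a ≐ 0#
  ... | true  = normalised-++ u v
  ... | false = refl

  normalised-concat-rows : ∀ {k m} (x : Vector F k) (ξ : Vector F m) → normalised F ξ ≡ true →
    normalised F (Data.Vec.concat (rows x ξ)) ≡ normalised F x
  normalised-concat-rows []      ξ ξ-n = refl
  normalised-concat-rows (a ∷ x) ξ ξ-n rewrite normalised-++ (scaleV F a ξ) (Data.Vec.concat (rows x ξ)) with a ≟ 0#
  ... | yes refl rewrite scaleV-zero ξ = normalised-concat-rows x ξ ξ-n
  ... | no  a≢0  rewrite scaleV-nonzero a ξ a≢0 (normalised⇒nonzero ξ ξ-n) = normalised-scaleV a ξ a≢0 ξ-n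

  ==M⇒≡ : ∀ {m} (A B : Mat F m) → _==M_ F A B ≡ true → A ≡ B
  ==M⇒≡ A B = does-true (Vec.≡-dec (Vec.≡-dec _≟_) A B)

  ≡⇒==M : ∀ {m} (A B : Mat F m) → A ≡ B → _==M_ F A B ≡ true
  ≡⇒==M A B = dec-true (Vec.≡-dec (Vec.≡-dec _≟_) A B)

  inΛ₁ : ∀ {m} → Mat F m → Bool
  inΛ₁ A = normalised F (flatten F A) ∧ inCone F A

  isFlag : ∀ {m} → Vector F m → Vector F m → Bool
  isFlag x ξ = normalised F x ∧ (normalised F ξ ∧ (dot F ξ x ≐ 0#))

  ∧-true : ∀ {a b} → (a ∧ b) ≡ true → a ≡ true × b ≡ true
  ∧-true {true} {true} _ = refl , refl

  not-true : ∀ {b} → not b ≡ true → b ≡ false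
  not-true {false} _ = refl

  ∧-intro : ∀ {a b} → a ≡ true → b ≡ true → (a ∧ b) ≡ true
  ∧-intro refl refl = refl

  isFlag-true : ∀ {m} (x ξ : Vector F m) → isFlag x ξ ≡ true →
    normalised F x ≡ true × normalised F ξ ≡ true × (dot F ξ x ≐ 0#) ≡ true
  isFlag-true x ξ flag with x-n , rest ← ∧-true {normalised F x} flag with ξ-n , ξx≐0 ← ∧-true {normalised F ξ} rest =
    x-n , ξ-n , ξx≐0

  flag⇒inΛ₁ : ∀ {m} (x ξ : Vector F m) → isFlag x ξ ≡ true → inΛ₁ (outer F x ξ) ≡ true
  flag⇒inΛ₁ {m} x ξ flag with x-n , ξ-n , ξx≐0 ← isFlag-true x ξ flag =
    ∧-intro (trans (normalised-concat-rows x ξ ξ-n) x-n) cone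
    where
    conditions : (not (isZeroV F x) ∧ not (isZeroV F ξ) ∧ (dot F ξ x ≐ 0#) ∧ _==M_ F (outer F x ξ) (outer F x ξ)) ≡ true
    conditions rewrite normalised⇒nonzero x x-n | normalised⇒nonzero ξ ξ-n | ξx≐0 =
      ≡⇒==M (outer F x ξ) (outer F x ξ) refl
    cone : inCone F (outer F x ξ) ≡ true
    cone = any-intro _ (allVectors-complete m x) (any-intro _ (allVectors-complete m ξ) conditions)

  inΛ₁⇒flag : ∀ {m} (A : Mat F m) → inΛ₁ A ≡ true →
    Σ (Vector F m) λ x → Σ (Vector F m) λ ξ → isFlag x ξ ≡ true × outer F x ξ ≡ A
  inΛ₁⇒flag {m} A A∈Λ₁
    with A-n , cone ← ∧-true {normalised F (flatten F A)} A∈Λ₁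
    with x , ∃ξ ← any-true _ (allVectors F m) cone
    with ξ , conditions ← any-true _ (allVectors F m) ∃ξ
    with _ , rest ← ∧-true {not (isZeroV F x)} conditions
    with ξ≠0 , rest ← ∧-true {not (isZeroV F ξ)} rest
    with ξx≐0 , xξ≐A ← ∧-true {dot F ξ x ≐ 0#} rest
    with c , c≢0 , cξ-n ← normalise ξ (not-true ξ≠0)
    = x′ , ξ′ , ∧-intro x′-n (∧-intro cξ-n ξ′x′≐0) , x′ξ′≡A
    where
    open ≡-Reasoning
    d = inv c c≢0
    x′ = scaleV F d x
    ξ′ = scaleV F c ξ
    x′ξ′≡A : outer F x′ ξ′ ≡ A
    x′ξ′≡A = trans (rows-scale c d x ξ (inverseˡ c c≢0)) (==M⇒≡ (outer F x ξ) A xξ≐A)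
    x′-n : normalised F x′ ≡ true
    x′-n = trans (sym (normalised-concat-rows x′ ξ′ cξ-n))
                 (subst (λ B → normalised F (flatten F B) ≡ true) (sym x′ξ′≡A) A-n)
    ξ′x′≐0 : (dot F ξ′ x′ ≐ 0#) ≡ true
    ξ′x′≐0 = dec-true (dot F ξ′ x′ ≟ 0#) (begin
      dot F (scaleV F c ξ) (scaleV F d x) ≡⟨ dot-scaleˡ c ξ _ ⟩
      c · dot F ξ (scaleV F d x)          ≡⟨ cong (c ·_) (dot-scaleʳ d ξ x) ⟩
      c · (d · dot F ξ x)                 ≡⟨ cong (λ t → c · (d · t)) (≐-true ξx≐0) ⟩
      c · (d · 0#)                        ≡⟨ cong (c ·_) (zeroʳ d) ⟩
      c · 0#                              ≡⟨ zeroʳ c ⟩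
      0#                                  ∎)

  module _ {m} (A : Mat F m) (K : ℕ) where

    private
      term : Vector F m → Vector F m → ℕ
      term x ξ = when (isFlag x ξ) (when (_==M_ F A (outer F x ξ)) K)

    ∑-flags-fibre-at : ∀ x₀ ξ₀ → isFlag x₀ ξ₀ ≡ true → outer F x₀ ξ₀ ≡ A →
      ∑[ x ← allVectors F m ] ∑[ ξ ← allVectors F m ] term x ξ ≡ K
    ∑-flags-fibre-at x₀ ξ₀ flag₀ x₀ξ₀≡A = begin
      ∑[ x ← allVectors F m ] ∑[ ξ ← allVectors F m ] term x ξ
        ≡⟨ ∑-cong (allVectors F m) (λ x → ∑-cong (allVectors F m) (λ ξ → point-mass x ξ)) ⟩
      ∑[ x ← allVectors F m ] ∑[ ξ ← allVectors F m ] when (does (Vec.≡-dec _≟_ x x₀)) (when (does (Vec.≡-dec _≟_ ξ ξ₀)) K)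
        ≡⟨ ∑-cong (allVectors F m) (λ x → ∑-when (allVectors F m) (does (Vec.≡-dec _≟_ x x₀)) _) ⟩
      ∑[ x ← allVectors F m ] when (does (Vec.≡-dec _≟_ x x₀)) (∑[ ξ ← allVectors F m ] when (does (Vec.≡-dec _≟_ ξ ξ₀)) K)
        ≡⟨ ∑-cong (allVectors F m) (λ x → cong (when (does (Vec.≡-dec _≟_ x x₀))) (allVectors-sifting m ξ₀ (λ _ → K))) ⟩
      ∑[ x ← allVectors F m ] when (does (Vec.≡-dec _≟_ x x₀)) K
        ≡⟨ allVectors-sifting m x₀ (λ _ → K) ⟩
      K ∎
      where
      open ≡-Reasoning
      elsewhere : ∀ x ξ → ¬ (x ≡ x₀ × ξ ≡ ξ₀) → term x ξ ≡ 0
      elsewhere x ξ x,ξ≢x₀,ξ₀ with isFlag x ξ in flag | _==M_ F A (outer F x ξ) in A≐xξ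
      ... | false | _     = refl
      ... | true  | false = refl
      ... | true  | true
        with x-n , ξ-n , _ ← isFlag-true x ξ flag
        with x₀-n , ξ₀-n , _ ← isFlag-true x₀ ξ₀ flag₀ =
        ⊥-elim (x,ξ≢x₀,ξ₀ (rows-injective x x₀ ξ ξ₀ x-n x₀-n ξ-n ξ₀-n
          (trans (sym (==M⇒≡ A (outer F x ξ) A≐xξ)) (sym x₀ξ₀≡A))))
      point-mass : ∀ x ξ → term x ξ ≡ when (does (Vec.≡-dec _≟_ x x₀)) (when (does (Vec.≡-dec _≟_ ξ ξ₀)) K)
      point-mass x ξ with Vec.≡-dec _≟_ x x₀ | Vec.≡-dec _≟_ ξ ξ₀
      ... | yes refl | yes refl = trans (cong (λ b → when b (when (_==M_ F A (outer F x ξ)) K)) flag₀)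
                                        (cong (λ b → when b K) (≡⇒==M A (outer F x ξ) (sym x₀ξ₀≡A)))
      ... | yes _    | no ξ≢ξ₀ = elsewhere x ξ (ξ≢ξ₀ ∘ proj₂)
      ... | no x≢x₀  | _       = elsewhere x ξ (x≢x₀ ∘ proj₁)

    ∑-flags-fibre : ∑[ x ← allVectors F m ] ∑[ ξ ← allVectors F m ] term x ξ ≡ when (inΛ₁ A) K
    ∑-flags-fibre with inΛ₁ A in A∈Λ₁
    ... | true  = let x₀ , ξ₀ , flag₀ , x₀ξ₀≡A = inΛ₁⇒flag A A∈Λ₁
                  in ∑-flags-fibre-at x₀ ξ₀ flag₀ x₀ξ₀≡A
    ... | false = ∑-zero (allVectors F m) λ x → ∑-zero (allVectors F m) λ ξ → outside x ξ
      where
      outside : ∀ x ξ → term x ξ ≡ 0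
      outside x ξ with isFlag x ξ in flag | _==M_ F A (outer F x ξ) in A≐xξ
      ... | false | _     = refl
      ... | true  | false = refl
      ... | true  | true with () ← trans (sym A∈Λ₁)
        (subst (λ B → inΛ₁ B ≡ true) (sym (==M⇒≡ A (outer F x ξ) A≐xξ)) (flag⇒inΛ₁ x ξ flag))

  ∑-Λ₁ : ∀ n (f : Mat F (suc n) → ℕ) →
    ∑ (Λ₁ F n) f ≡ ∑[ x ← allVectors F (suc n) ] ∑[ ξ ← allVectors F (suc n) ] when (isFlag x ξ) (f (outer F x ξ))
  ∑-Λ₁ n f = begin
    ∑ (Λ₁ F n) f
      ≡⟨ ∑-filter (allMats F m) inΛ₁ f ⟩
    ∑[ A ← allMats F m ] when (inΛ₁ A) (f A)
      ≡⟨ ∑-cong (allMats F m) (λ A → sym (∑-flags-fibre A (f A))) ⟩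
    ∑[ A ← allMats F m ] ∑[ x ← allVectors F m ] ∑[ ξ ← allVectors F m ] when (isFlag x ξ) (when (_==M_ F A (outer F x ξ)) (f A))
      ≡⟨ ∑-comm (allMats F m) (allVectors F m) _ ⟩
    ∑[ x ← allVectors F m ] ∑[ A ← allMats F m ] ∑[ ξ ← allVectors F m ] when (isFlag x ξ) (when (_==M_ F A (outer F x ξ)) (f A))
      ≡⟨ ∑-cong (allVectors F m) (λ x → ∑-comm (allMats F m) (allVectors F m) _) ⟩
    ∑[ x ← allVectors F m ] ∑[ ξ ← allVectors F m ] ∑[ A ← allMats F m ] when (isFlag x ξ) (when (_==M_ F A (outer F x ξ)) (f A))
      ≡⟨ ∑-cong (allVectors F m) (λ x → ∑-cong (allVectors F m) (λ ξ → ∑-when (allMats F m) (isFlag x ξ) _)) ⟩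
    ∑[ x ← allVectors F m ] ∑[ ξ ← allVectors F m ] when (isFlag x ξ) (∑[ A ← allMats F m ] when (_==M_ F A (outer F x ξ)) (f A))
      ≡⟨ ∑-cong (allVectors F m) (λ x → ∑-cong (allVectors F m) (λ ξ → cong (when (isFlag x ξ)) (allMats-sifting m (outer F x ξ) f))) ⟩
    ∑[ x ← allVectors F m ] ∑[ ξ ← allVectors F m ] when (isFlag x ξ) (f (outer F x ξ)) ∎
    where
    open ≡-Reasoning
    m = suc n

  -- Linear functionals on M_m(F) are trace forms

  dot≡sum : ∀ {k} (u v : Vector F k) → dot F u v ≡ sum (λ i → lookup u i · lookup v i)
  dot≡sum []      []      = refl
  dot≡sum (a ∷ u) (b ∷ v) = cong (a · b +_) (dot≡sum u v)

  traceForm : ∀ {m} → Mat F m → Mat F m → Carrier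
  traceForm M A = sum λ i → sum λ j → lookup (lookup A i) j · lookup (lookup M j) i

  traceForm-outer : ∀ {m} (M : Mat F m) (x ξ : Vector F m) → traceForm M (outer F x ξ) ≡ dot F (rowMul F ξ M) x
  traceForm-outer {m} M x ξ = sym (begin
    dot F (rowMul F ξ M) x
      ≡⟨ dot≡sum (rowMul F ξ M) x ⟩
    sum (λ i → lookup (rowMul F ξ M) i · lookup x i)
      ≡⟨ sum-cong-≗ (λ i → cong (_· lookup x i) (trans (Vec.lookup∘tabulate _ i) (dot≡sum ξ _))) ⟩
    sum (λ i → sum (λ j → lookup ξ j · lookup (column i) j) · lookup x i)
      ≡⟨ sum-cong-≗ (λ i → *-distribʳ-sum (lookup x i) (λ j → lookup ξ j · lookup (column i) j)) ⟩
    sum (λ i → sum (λ j → lookup ξ j · lookup (column i) j · lookup x i))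
      ≡⟨ sum-cong-≗ (λ i → sum-cong-≗ (λ j → entry i j)) ⟩
    traceForm M (outer F x ξ) ∎)
    where
    open ≡-Reasoning
    column : Fin m → Vector F m
    column i = Data.Vec.map (λ row → lookup row i) M
    entry : ∀ i j → lookup ξ j · lookup (column i) j · lookup x i
                  ≡ lookup (lookup (outer F x ξ) i) j · lookup (lookup M j) i
    entry i j
      rewrite Vec.lookup-map j (λ row → lookup row i) M
            | Vec.lookup-map i (λ a → scaleV F a ξ) x
            | Vec.lookup-map j (lookup x i ·_) ξ
      = xy∙z≈zx∙y (lookup ξ j) (lookup (lookup M j) i) (lookup x i)

  traceForm-linear : ∀ {m} (M : Mat F m) → IsLinear F (traceForm M)
  traceForm-linear M = additive , homogeneous
    where
    term : ∀ {m} → Mat F m → Mat F m → Fin m → Fin m → Carrier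
    term M A i j = lookup (lookup A i) j · lookup (lookup M j) i
    additive : ∀ A B → traceForm M (addM F A B) ≡ traceForm M A + traceForm M B
    additive A B = trans
      (sum-cong-≗ λ i → trans (sum-cong-≗ λ j → entry i j) (∑-distrib-+ (term M A i) (term M B i)))
      (∑-distrib-+ (λ i → sum (term M A i)) (λ i → sum (term M B i)))
      where
      entry : ∀ i j → term M (addM F A B) i j ≡ term M A i j + term M B i j
      entry i j rewrite Vec.lookup-zipWith (zipWith _+_) i A B | Vec.lookup-zipWith _+_ j (lookup A i) (lookup B i) =
        distribʳ _ _ _
    homogeneous : ∀ c A → traceForm M (scaleM F c A) ≡ c · traceForm M A
    homogeneous c A = trans
      (sum-cong-≗ λ i → trans (sum-cong-≗ λ j → entry i j) (sym (*-distribˡ-sum c (term M A i))))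
      (sym (*-distribˡ-sum c (λ i → sum (term M A i))))
      where
      entry : ∀ i j → term M (scaleM F c A) i j ≡ c · term M A i j
      entry i j rewrite Vec.lookup-map i (scaleV F c) A | Vec.lookup-map j (c ·_) (lookup A i) = *-assoc _ _ _

  IsLinearOn : {V : Set} → (V → V → V) → (Carrier → V → V) → (V → Carrier) → Set
  IsLinearOn _⊞_ _⊡_ ψ = (∀ u v → ψ (u ⊞ v) ≡ ψ u + ψ v) × (∀ c u → ψ (c ⊡ u) ≡ c · ψ u)

  zeros : ∀ {k} → Vector F k
  zeros = replicate _ 0#

  zeroRows : ∀ {k m} → Vec (Vector F m) k
  zeroRows = replicate _ zeros

  unit : ∀ {k} → Fin k → Vector F k
  unit fzero    = 1# ∷ zeros
  unit (fsuc j) = 0# ∷ unit j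

  unitMat : ∀ {k m} → Fin k → Fin m → Vec (Vector F m) k
  unitMat fzero    j = unit j ∷ zeroRows
  unitMat (fsuc i) j = zeros ∷ unitMat i j

  +-zerosˡ : ∀ {k} (v : Vector F k) → zipWith _+_ zeros v ≡ v
  +-zerosˡ []      = refl
  +-zerosˡ (a ∷ v) = cong₂ _∷_ (+-identityˡ a) (+-zerosˡ v)

  +-zerosʳ : ∀ {k} (v : Vector F k) → zipWith _+_ v zeros ≡ v
  +-zerosʳ []      = refl
  +-zerosʳ (a ∷ v) = cong₂ _∷_ (+-identityʳ a) (+-zerosʳ v)

  scaleV-zeros : ∀ {k} c → scaleV F c (zeros {k}) ≡ zeros
  scaleV-zeros {k} c = trans (Vec.map-replicate (c ·_) 0# k) (cong (replicate k) (zeroʳ c))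

  +-zeroRowsˡ : ∀ {k m} (A : Vec (Vector F m) k) → zipWith (zipWith _+_) zeroRows A ≡ A
  +-zeroRowsˡ []      = refl
  +-zeroRowsˡ (r ∷ A) = cong₂ _∷_ (+-zerosˡ r) (+-zeroRowsˡ A)

  scale-zeroRows : ∀ {k m} c → Data.Vec.map (scaleV F c) (zeroRows {k} {m}) ≡ zeroRows
  scale-zeroRows {k} c = trans (Vec.map-replicate (scaleV F c) zeros k) (cong (replicate k) (scaleV-zeros c))

  linear-expansionᵛ : ∀ {k} (ψ : Vector F k → Carrier) → IsLinearOn (zipWith _+_) (scaleV F) ψ →
    ∀ v → ψ v ≡ sum (λ j → lookup v j · ψ (unit j))
  linear-expansionᵛ ψ (additive , homogeneous) []      = trans (homogeneous 0# []) (zeroˡ _)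
  linear-expansionᵛ ψ (additive , homogeneous) (a ∷ v) = begin
    ψ (a ∷ v)
      ≡⟨ cong ψ (sym (cong₂ _∷_ (+-identityʳ a) (+-zerosˡ v))) ⟩
    ψ (zipWith _+_ (a ∷ zeros) (0# ∷ v))
      ≡⟨ additive _ _ ⟩
    ψ (a ∷ zeros) + ψ (0# ∷ v)
      ≡⟨ cong₂ _+_ head (linear-expansionᵛ (λ w → ψ (0# ∷ w)) tail-linear v) ⟩
    a · ψ (unit fzero) + sum (λ j → lookup v j · ψ (unit (fsuc j))) ∎
    where
    open ≡-Reasoning
    head : ψ (a ∷ zeros) ≡ a · ψ (unit fzero)
    head = trans (cong ψ (sym (cong₂ _∷_ (*-identityʳ a) (scaleV-zeros a)))) (homogeneous a (unit fzero))
    tail-linear : IsLinearOn (zipWith _+_) (scaleV F) (λ w → ψ (0# ∷ w))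
    tail-linear =
        (λ u w → trans (cong (λ t → ψ (t ∷ zipWith _+_ u w)) (sym (+-identityˡ 0#))) (additive (0# ∷ u) (0# ∷ w)))
      , (λ c u → trans (cong (λ t → ψ (t ∷ scaleV F c u)) (sym (zeroʳ c))) (homogeneous c (0# ∷ u)))

  linear-expansion : ∀ {k m} (ψ : Vec (Vector F m) k → Carrier) →
    IsLinearOn (zipWith (zipWith _+_)) (λ c → Data.Vec.map (scaleV F c)) ψ →
    ∀ A → ψ A ≡ sum (λ i → sum (λ j → lookup (lookup A i) j · ψ (unitMat i j)))
  linear-expansion ψ (additive , homogeneous) []      = trans (homogeneous 0# []) (zeroˡ _)
  linear-expansion ψ (additive , homogeneous) (r ∷ A) = begin
    ψ (r ∷ A)
      ≡⟨ cong ψ (sym (cong₂ _∷_ (+-zerosʳ r) (+-zeroRowsˡ A))) ⟩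
    ψ (zipWith (zipWith _+_) (r ∷ zeroRows) (zeros ∷ A))
      ≡⟨ additive _ _ ⟩
    ψ (r ∷ zeroRows) + ψ (zeros ∷ A)
      ≡⟨ cong₂ _+_ (linear-expansionᵛ (λ v → ψ (v ∷ zeroRows)) head-linear r)
                   (linear-expansion (λ B → ψ (zeros ∷ B)) tail-linear A) ⟩
    sum (λ j → lookup r j · ψ (unitMat fzero j))
      + sum (λ i → sum (λ j → lookup (lookup A i) j · ψ (unitMat (fsuc i) j))) ∎
    where
    open ≡-Reasoning
    head-linear : IsLinearOn (zipWith _+_) (scaleV F) (λ v → ψ (v ∷ zeroRows))
    head-linear =
        (λ u w → trans (cong (λ B → ψ (zipWith _+_ u w ∷ B)) (sym (+-zeroRowsˡ zeroRows)))
                       (additive (u ∷ zeroRows) (w ∷ zeroRows)))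
      , (λ c u → trans (cong (λ B → ψ (scaleV F c u ∷ B)) (sym (scale-zeroRows c))) (homogeneous c (u ∷ zeroRows)))
    tail-linear : IsLinearOn (zipWith (zipWith _+_)) (λ c → Data.Vec.map (scaleV F c)) (λ B → ψ (zeros ∷ B))
    tail-linear =
        (λ B C → trans (cong (λ r → ψ (r ∷ zipWith (zipWith _+_) B C)) (sym (+-zerosˡ zeros)))
                       (additive (zeros ∷ B) (zeros ∷ C)))
      , (λ c B → trans (cong (λ r → ψ (r ∷ Data.Vec.map (scaleV F c) B)) (sym (scaleV-zeros c)))
                       (homogeneous c (zeros ∷ B)))

  matrixOf : ∀ {m} → (Mat F m → Carrier) → Mat F m
  matrixOf φ = tabulate λ j → tabulate λ i → φ (unitMat i j)

  linear⇒traceForm : ∀ {m} (φ : Mat F m → Carrier) → IsLinear F φ → ∀ A → φ A ≡ traceForm (matrixOf φ) A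
  linear⇒traceForm φ φ-linear A = trans (linear-expansion φ φ-linear A) (sum-cong-≗ λ i → sum-cong-≗ λ j →
    cong (lookup (lookup A i) j ·_)
         (sym (trans (cong (λ row → lookup row i) (Vec.lookup∘tabulate _ j)) (Vec.lookup∘tabulate _ i))))

  θ-complement : ∀ n (M : Mat F (suc n)) K →
    K *ℕ θ F M +ℕ ∑[ ξ ← allVectors F (suc n) ] when (normalised F ξ) (when (not (isLeftEigen F M ξ)) K)
      ≡ K *ℕ projCount F n
  θ-complement n M K = begin
    K *ℕ θ F M +ℕ W
      ≡⟨ cong (λ t → K *ℕ t +ℕ W) (length-filter≡∑ (allVectors F m) (λ ξ → normalised F ξ ∧ eigen ξ)) ⟩
    K *ℕ ∑[ ξ ← allVectors F m ] when (normalised F ξ ∧ eigen ξ) 1 +ℕ W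
      ≡⟨ cong (_+ℕ W) (sym (∑-*ˡ (allVectors F m) K _)) ⟩
    ∑[ ξ ← allVectors F m ] (K *ℕ when (normalised F ξ ∧ eigen ξ) 1) +ℕ W
      ≡⟨ sym (∑-+ (allVectors F m) _ _) ⟩
    ∑[ ξ ← allVectors F m ] (K *ℕ when (normalised F ξ ∧ eigen ξ) 1 +ℕ when (normalised F ξ) (when (not (eigen ξ)) K))
      ≡⟨ ∑-cong (allVectors F m) (λ ξ → split (normalised F ξ) (eigen ξ)) ⟩
    ∑[ ξ ← allVectors F m ] (K *ℕ when (normalised F ξ) 1)
      ≡⟨ ∑-*ˡ (allVectors F m) K _ ⟩
    K *ℕ ∑[ ξ ← allVectors F m ] when (normalised F ξ) 1
      ≡⟨ cong (K *ℕ_) (∑-normalised≡projCount n) ⟩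
    K *ℕ projCount F n ∎
    where
    open ≡-Reasoning
    m = suc n
    eigen : Vector F m → Bool
    eigen = isLeftEigen F M
    W = ∑[ ξ ← allVectors F m ] when (normalised F ξ) (when (not (eigen ξ)) K)
    split : ∀ a b → K *ℕ when (a ∧ b) 1 +ℕ when a (when (not b) K) ≡ K *ℕ when a 1
    split false b     = ℕ.+-identityʳ _
    split true  true  = ℕ.+-identityʳ _
    split true  false = trans (cong (_+ℕ K) (ℕ.*-zeroʳ K)) (sym (ℕ.*-identityʳ K))

  weight-traceForm≡∑-hyperplanes : ∀ n (M : Mat F (suc n)) →
    weight F (codeword F n (traceForm M)) ≡
      ∑[ ξ ← allVectors F (suc n) ] when (normalised F ξ)
        (∑[ x ← allVectors F (suc n) ] when (normalised F x) (when (dot F ξ x ≐ 0#) (𝟙≢0 (dot F (rowMul F ξ M) x))))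
  weight-traceForm≡∑-hyperplanes n M = begin
    weight F (map (traceForm M) (Λ₁ F n))
      ≡⟨ length-filter≡∑ (map (traceForm M) (Λ₁ F n)) (λ a → not (a ≐ 0#)) ⟩
    ∑ (map (traceForm M) (Λ₁ F n)) 𝟙≢0
      ≡⟨ ∑-map (Λ₁ F n) (traceForm M) 𝟙≢0 ⟩
    ∑[ A ← Λ₁ F n ] 𝟙≢0 (traceForm M A)
      ≡⟨ ∑-Λ₁ n (λ A → 𝟙≢0 (traceForm M A)) ⟩
    ∑[ x ← allVectors F m ] ∑[ ξ ← allVectors F m ] when (isFlag x ξ) (𝟙≢0 (traceForm M (outer F x ξ)))
      ≡⟨ ∑-cong (allVectors F m) (λ x → ∑-cong (allVectors F m) (λ ξ → cong (λ a → when (isFlag x ξ) (𝟙≢0 a)) (traceForm-outer M x ξ))) ⟩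
    ∑[ x ← allVectors F m ] ∑[ ξ ← allVectors F m ] when (isFlag x ξ) (𝟙≢0 (dot F (rowMul F ξ M) x))
      ≡⟨ ∑-comm (allVectors F m) (allVectors F m) _ ⟩
    ∑[ ξ ← allVectors F m ] ∑[ x ← allVectors F m ] when (isFlag x ξ) (𝟙≢0 (dot F (rowMul F ξ M) x))
      ≡⟨ ∑-cong (allVectors F m) (λ ξ → ∑-cong (allVectors F m) (λ x → flag-by-hyperplane x ξ)) ⟩
    ∑[ ξ ← allVectors F m ] ∑[ x ← allVectors F m ] when (normalised F ξ) (term ξ x)
      ≡⟨ ∑-cong (allVectors F m) (λ ξ → ∑-when (allVectors F m) (normalised F ξ) (term ξ)) ⟩
    ∑[ ξ ← allVectors F m ] when (normalised F ξ) (∑ (allVectors F m) (term ξ)) ∎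
    where
    open ≡-Reasoning
    m = suc n
    term : Vector F m → Vector F m → ℕ
    term ξ x = when (normalised F x) (when (dot F ξ x ≐ 0#) (𝟙≢0 (dot F (rowMul F ξ M) x)))
    flag-by-hyperplane : ∀ x ξ → when (isFlag x ξ) (𝟙≢0 (dot F (rowMul F ξ M) x)) ≡ when (normalised F ξ) (term ξ x)
    flag-by-hyperplane x ξ with normalised F x | normalised F ξ
    ... | true  | true  = refl
    ... | true  | false = refl
    ... | false | true  = refl
    ... | false | false = refl

  weight-traceForm : ∀ n (M : Mat F (suc n)) →
    weight F (codeword F n (traceForm M)) ≡ q ^ (n ∸ 1) *ℕ projCount F n ∸ q ^ (n ∸ 1) *ℕ θ F M
  weight-traceForm n M = begin
    weight F (codeword F n (traceForm M))
      ≡⟨ weight-traceForm≡∑-hyperplanes n M ⟩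
    ∑[ ξ ← allVectors F (suc n) ] when (normalised F ξ) _
      ≡⟨ ∑-cong (allVectors F (suc n)) (λ ξ → when-congʳ (normalised F ξ) (count-normalised-dot≡0-rowMul≢0 n M ξ)) ⟩
    W
      ≡⟨ sym (ℕ.m+n∸m≡n (K *ℕ θ F M) W) ⟩
    K *ℕ θ F M +ℕ W ∸ K *ℕ θ F M
      ≡⟨ cong (_∸ K *ℕ θ F M) (θ-complement n M K) ⟩
    K *ℕ projCount F n ∸ K *ℕ θ F M ∎
    where
    open ≡-Reasoning
    K = q ^ (n ∸ 1)
    W = ∑[ ξ ← allVectors F (suc n) ] when (normalised F ξ) (when (not (isLeftEigen F M ξ)) K)

corollary3p6 : (F : FiniteField) (n w : ℕ) →
    (IsWeightOfCΛ₁ F n w → Σ (Mat F (suc n)) λ M →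
        w ≡ FiniteField.q F ^ (n ∸ 1) * projCount F n ∸ FiniteField.q F ^ (n ∸ 1) * θ F M)
    × ((Σ (Mat F (suc n)) λ M →
        w ≡ FiniteField.q F ^ (n ∸ 1) * projCount F n ∸ FiniteField.q F ^ (n ∸ 1) * θ F M)
       → IsWeightOfCΛ₁ F n w)
corollary3p6 F n w = weight⇒formula , formula⇒weight
  where
  open ≡-Reasoning
  HasWeightFormula : Mat F (suc n) → Set
  HasWeightFormula M = w ≡ FiniteField.q F ^ (n ∸ 1) * projCount F n ∸ FiniteField.q F ^ (n ∸ 1) * θ F M

  weight⇒formula : IsWeightOfCΛ₁ F n w → Σ (Mat F (suc n)) HasWeightFormula
  weight⇒formula (φ , φ-linear , weight≡w) = matrixOf F φ , (begin
    w
      ≡⟨ sym weight≡w ⟩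
    weight F (codeword F n φ)
      ≡⟨ cong (weight F) (map-cong (linear⇒traceForm F φ φ-linear) (Λ₁ F n)) ⟩
    weight F (codeword F n (traceForm F (matrixOf F φ)))
      ≡⟨ weight-traceForm F n (matrixOf F φ) ⟩
    _ ∎)

  formula⇒weight : Σ (Mat F (suc n)) HasWeightFormula → IsWeightOfCΛ₁ F n w
  formula⇒weight (M , w≡formula) = traceForm F M , traceForm-linear F M , trans (weight-traceForm F n M) (sym w≡formula)
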